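{- Let $2\le k\le n$ be integers, $V=[n]$, and ${\bf d}\in\mathbb Z^n$. (All quantities below are assumed to be defined, i.e. the relevant counts $\mathcal N(\cdot)$ in denominators are positive.) (a) For distinct $a,b\in V$, if ${\bf d}-{\bf e}_a$ and ${\bf d}-{\bf e}_b$ are $k$-graphical and $B(b,a,{\bf d}-{\bf e}_a)<1$, then $$R_{ab}({\bf d})=\frac{d_a}{d_b}\cdot\frac{1-B(a,b,{\bf d}-{\bf e}_b)}{1-B(b,a,{\bf d}-{\bf e}_a)},$$ where for $\{i,j\}=\{a,b\}$ and ${\bf d}'\in\mathbb Z^n$, $$B(i,j,{\bf d}')=\frac1{d_i}\left(\sum_{K\in\binom{V\setminus\{a,b\}}{k-2}}P_{K\cup\{i,j\}}({\bf d}')+\sum_{K\in\binom{V\setminus\{a,b\}}{k-1}}Y_{i,K,j}({\bf d}')\right).$$ (b) Let $A\in\binom V{k-1}$ and $v\in V\setminus A$. If $P_{A\cup\{v\}}({\bf d})>0$ and, for every $B\in\binom{V\setminus\{v\}}{k-1}$ with $A$-consistent ordering $(a_1,\dots,a_{k-1}),(b_1,\dots,b_{k-1})$ and every $j\in\{0,1,\dots,k-1\}$, the sequence ${\bf d}-{\bf e}_v-{\bf e}_{\{b_1,\dots,b_j,a_{j+1},\dots,a_{k-1}\}}$ is $k$-graphical, then $$P_{A\cup\{v\}}({\bf d})=d_v\left(\sum_{B\in\binom{V\setminus\{v\}}{k-1}}R_{B,A}({\bf d}-{\bf e}_v)\,\frac{1-P_{B\cup\{v\}}({\bf d}-{\bf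 e}_{B\cup\{v\}})}{1-P_{A\cup\{v\}}({\bf d}-{\bf e}_{A\cup\{v\}})}\right)^{ -1}.$$ (c) For $K\in\binom V{k-1}$ and distinct $a,b\in V\setminus K$, if $P_{K\cup\{a\}}({\bf d}-{\bf e}_{K\cup\{a\}})<1$, then $$Y_{a,K,b}({\bf d})=\frac{P_{K\cup\{a\}}({\bf d})}{1-P_{K\cup\{a\}}({\bf d}-{\bf e}_{K\cup\{a\}})}\Bigl(P_{K\cup\{b\}}({\bf d}-{\bf e}_{K\cup\{a\}})-Y_{a,K,b}({\bf d}-{\bf e}_{K\cup\{a\}})\Bigr).$$
   Context: ${\bf e}_a$ is the $a$-th standard basis vector of $\mathbb Z^n$ and ${\bf e}_K=\sum_{a\in K}{\bf e}_a$ for $K\subseteq V$. A $k$-graph on $V$ is a set of $k$-subsets of $V$. $\mathcal N({\bf d})$ is the number of $k$-graphs on $V$ with degree sequence ${\bf d}$; ${\bf d}$ is $k$-graphical if $\mathcal N({\bf d})>0$. For $L\in\binom Vk$, $\mathcal N_L({\bf d})$ is the number of such $k$-graphs containing edge $L$, and $\mathcal N_{J,L}({\bf d})$ the number containing both edges $J\neq L$. Define $R_{ab}({\bf d})=\mathcal N({\bf d}-{\bf e}_a)/\mathcal N({\bf d}-{\bf e}_b)$; $P_L({\bf d})=\mathcal N_L({\bf d})/\mathcal N({\bf d})$; for $K\in\binom V{k-1}$ and distinct $a,b\notin K$, $Y_{a,K,b}({\bf d})=\mathcal N_{K\cup\{a\},K\cup\{b\}}({\bf d})/\mathcal N({\bf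 d})$, and $Y_{a,K,a}({\bf d})=0$. For $A,B\in\binom V{k-1}$, the $A$-consistent ordering is the ordering $(a_1,\dots,a_{k-1})$ of $A$ and $(b_1,\dots,b_{k-1})$ of $B$ such that $a_1<\dots<a_{k-1}$; whenever $b_i\in A$ then $b_i=a_i$; and the elements $b_i\notin A$ appear in increasing order. Then $R_{B,A}({\bf d})=\prod_{j=1}^{k-1}R_{b_ja_j}({\bf d}-{\bf e}_{\{b_1,\dots,b_{j-1},a_{j+1},\dots,a_{k-1}\}})$. -}

module Defs where

open import Data.Nat as ℕ using (ℕ; zero; suc)
open import Data.Bool.Base using (Bool; true; false; if_then_else_; _∧_; not)
open import Data.Fin using (Fin)
open import Data.Fin.Properties as FinP using ()
open import Data.Fin.Subset using (Subset; ⊥; ⁅_⁆; _∪_; ∣_∣)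
open import Data.Vec using (Vec; []; _∷_; lookup)
open import Data.List using (List; []; _∷_; map; _++_; length; filterᵇ; foldr; allFin; take; drop)
open import Data.Integer as ℤ using (ℤ)
open import Data.Rational as ℚ using (ℚ; 0ℚ; 1ℚ; _+_; _*_; _-_)
open import Data.Rational.Properties as ℚP using ()
open import Relation.Nullary using (does; yes; no)

-- Finite enumerations (each object listed exactly once)

allSubsets : (n : ℕ) → List (Subset n)
allSubsets zero    = [] ∷ []
allSubsets (suc n) = map (true ∷_) (allSubsets n) ++ map (false ∷_) (allSubsets n)

kSubsets : (n k : ℕ) → List (Subset n)
kSubsets n k = filterᵇ (λ s → does (∣ s ∣ ℕ.≟ k)) (allSubsets n)

sublists : {A : Set} → List A → List (List A)
sublists []       = [] ∷ []
sublists (x ∷ xs) = map (x ∷_) (sublists xs) ++ sublists xs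

kGraphs : (n k : ℕ) → List (List (Subset n))
kGraphs n k = sublists (kSubsets n k)

anyᵇ : {A : Set} → (A → Bool) → List A → Bool
anyᵇ p = foldr (λ x r → if p x then true else r) false

allᵇ : {A : Set} → (A → Bool) → List A → Bool
allᵇ p = foldr (λ x r → p x ∧ r) true

eqSub : {n : ℕ} → Subset n → Subset n → Bool
eqSub []       []       = true
eqSub (x ∷ xs) (y ∷ ys) = (if x then y else not y) ∧ eqSub xs ys

memᵇ : {n : ℕ} → Fin n → Subset n → Bool
memᵇ a s = lookup s a

DegSeq : ℕ → Set
DegSeq n = Fin n → ℤ

deg : {n : ℕ} → List (Subset n) → Fin n → ℕ
deg G a = length (filterᵇ (memᵇ a) G)

hasDegSeq : {n : ℕ} → DegSeq n → List (Subset n) → Bool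
hasDegSeq {n} d G = allᵇ (λ a → does (ℤ.+ deg G a ℤ.≟ d a)) (allFin n)

hasEdge : {n : ℕ} → Subset n → List (Subset n) → Bool
hasEdge L G = anyᵇ (eqSub L) G

-- e_K  (e_a = e_{⁅ a ⁆})
eSet : {n : ℕ} → Subset n → DegSeq n
eSet K a = if memᵇ a K then ℤ.+ 1 else ℤ.+ 0

_−e_ : {n : ℕ} → DegSeq n → Subset n → DegSeq n
(d −e K) a = d a ℤ.- eSet K a

N : (n k : ℕ) → DegSeq n → ℕ
N n k d = length (filterᵇ (hasDegSeq d) (kGraphs n k))

NL : (n k : ℕ) → Subset n → DegSeq n → ℕ
NL n k L d = length (filterᵇ (λ G → hasDegSeq d G ∧ hasEdge L G) (kGraphs n k))

NJL : (n k : ℕ) → Subset n → Subset n → DegSeq n → ℕ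
NJL n k J L d =
  length (filterᵇ (λ G → hasDegSeq d G ∧ hasEdge J G ∧ hasEdge L G) (kGraphs n k))

-- Rational arithmetic (total versions; only used where the paper's
-- quantities are defined, i.e. denominators nonzero)

frac : ℕ → ℕ → ℚ
frac m zero    = 0ℚ
frac m (suc q) = ℤ.+ m ℚ./ suc q

inv : ℚ → ℚ
inv q with q ℚP.≟ 0ℚ
... | yes _  = 0ℚ
... | no q≢0 = ℚ.1/_ q {{ℚ.≢-nonZero q≢0}}

toℚ : ℤ → ℚ
toℚ z = z ℚ./ 1

sumℚ : List ℚ → ℚ
sumℚ = foldr _+_ 0ℚ

R : (n k : ℕ) → Fin n → Fin n → DegSeq n → ℚ
R n k a b d = frac (N n k (d −e ⁅ a ⁆)) (N n k (d −e ⁅ b ⁆))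

P : (n k : ℕ) → Subset n → DegSeq n → ℚ
P n k L d = frac (NL n k L d) (N n k d)

-- Y_{a,K,b}(d) ; Y_{a,K,a}(d) = 0
Y : (n k : ℕ) → Fin n → Subset n → Fin n → DegSeq n → ℚ
Y n k a K b d with a FinP.≟ b
... | yes _ = 0ℚ
... | no  _ = frac (NJL n k (K ∪ ⁅ a ⁆) (K ∪ ⁅ b ⁆) d) (N n k d)

elems : {n : ℕ} → Subset n → List (Fin n)
elems {n} s = filterᵇ (λ i → memᵇ i s) (allFin n)

fromList : {n : ℕ} → List (Fin n) → Subset n
fromList = foldr (λ x s → ⁅ x ⁆ ∪ s) ⊥

setMinus : {n : ℕ} → Subset n → Subset n → Subset n
setMinus []       []       = []
setMinus (x ∷ xs) (y ∷ ys) = (x ∧ not y) ∷ setMinus xs ys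

-- walk through a_1 < ... < a_{k-1}; keep a_i if a_i ∈ B, otherwise take the
-- next element of B ∖ A (in increasing order)
arrange : {n : ℕ} → Subset n → List (Fin n) → List (Fin n) → List (Fin n)
arrange B []       q       = []
arrange B (x ∷ xs) q with memᵇ x B
arrange B (x ∷ xs) q       | true  = x ∷ arrange B xs q
arrange B (x ∷ xs) []      | false = []
arrange B (x ∷ xs) (y ∷ q) | false = y ∷ arrange B xs q

ordA : {n : ℕ} → Subset n → List (Fin n)
ordA A = elems A

ordB : {n : ℕ} → Subset n → Subset n → List (Fin n)
ordB A B = arrange B (elems A) (elems (setMinus B A))

mixSet : {n : ℕ} → Subset n → Subset n → ℕ → Subset n
mixSet A B j = fromList (take j (ordB A B) ++ drop j (ordA A))

-- ∏_j R_{b_j a_j}(d - e_{{b_1..b_{j-1}, a_{j+1}..a_{k-1}}}), pre = {b_1..b_{j-1}}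
RBAgo : (n k : ℕ) → DegSeq n → Subset n → List (Fin n) → List (Fin n) → ℚ
RBAgo n k d pre (a ∷ as) (b ∷ bs) =
  R n k b a (d −e (pre ∪ fromList as)) * RBAgo n k d (pre ∪ ⁅ b ⁆) as bs
RBAgo n k d pre _ _ = 1ℚ

RBA : (n k : ℕ) → Subset n → Subset n → DegSeq n → ℚ
RBA n k B A d = RBAgo n k d ⊥ (ordA A) (ordB A B)

Bfun : (n k : ℕ) → DegSeq n → Fin n → Fin n → Fin n → Fin n → DegSeq n → ℚ
Bfun n k d a b i j d' =
  inv (toℚ (d i)) *
    (sumℚ (map (λ K → P n k (K ∪ (⁅ i ⁆ ∪ ⁅ j ⁆)) d') (avoid (k ℕ.∸ 2)))
     + sumℚ (map (λ K → Y n k i K j d') (avoid (k ℕ.∸ 1))))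
  where
  avoid : ℕ → List (Subset n)
  avoid m = filterᵇ (λ K → not (memᵇ a K) ∧ not (memᵇ b K)) (kSubsets n m)

kSubsetsAvoiding : (n m : ℕ) → Fin n → List (Subset n)
kSubsetsAvoiding n m v = filterᵇ (λ B → not (memᵇ v B)) (kSubsets n m)

-- Two counting facts about k-graphs with a prescribed degree sequence carry the whole argument.
-- First, deleting an edge L is a bijection from the graphs with degrees d containing L onto the
-- graphs with degrees d − e_L avoiding L, so 𝒩(d − e_L) = 𝒩_L(d − e_L) + 𝒩_L(d), that is
-- 1 − P_L(d − e_L) = 𝒩_L(d) / 𝒩(d − e_L); the same holds with a second prescribed edge.
-- Second, counting incidences between a vertex v and the edges through it gives
-- ∑_B 𝒩_{B ∪ {v}}(d) = d_v 𝒩(d), and for a ≠ b the edges through a split according to whether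
-- they contain b.
-- Part (c) is then a rearrangement of these fractions. In part (b) the product R_{B,A} telescopes to
-- 𝒩(d − e_{B ∪ {v}}) / 𝒩(d − e_{A ∪ {v}}), which turns every summand into 𝒩_{B ∪ {v}}(d) / 𝒩_{A ∪ {v}}(d),
-- and the sum into d_v 𝒩(d) / 𝒩_{A ∪ {v}}(d). In part (a), d_a 𝒩(d − e_b) and d_b 𝒩(d − e_a) exceed
-- the numerators of the two B's by the number of graphs containing K ∪ {a} but not K ∪ {b}
-- (resp. the reverse), summed over K; exchanging these two edges shows that both excesses agree.

module Submission where

open import Defs
open import Data.Nat as ℕ using (ℕ; zero; suc; _≤_; _∸_; z≤n; s≤s)
import Data.Nat.Properties as ℕP
open import Algebra.Properties.CommutativeSemigroup ℕP.+-commutativeSemigroup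
  using () renaming (interchange to +-interchange; x∙yz≈y∙xz to +-left-comm)
open import Data.Bool.Base using (Bool; true; false; if_then_else_; _∧_; _∨_; not; T)
import Data.Bool.Properties as BP
open import Data.Fin using (Fin; zero; suc)
import Data.Fin.Properties as FP
open import Data.Fin.Subset using (Subset; ⁅_⁆; _∪_; ∣_∣; _∉_; ⊥)
import Data.Fin.Subset.Properties as SubsetP
open import Data.Vec using ([]; _∷_; lookup)
import Data.Vec.Properties as VP
open import Data.List using (List; []; _∷_; map; _++_; length; filterᵇ; allFin; take; drop)
import Data.List.Properties as LP
open import Data.List.Relation.Unary.All as All using (All; []; _∷_)
import Data.List.Relation.Unary.All.Properties as AllP
open import Data.List.Relation.Unary.Any as Any using (here; there)
import Data.List.Relation.Unary.Any.Properties as AnyP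
open import Data.List.Relation.Unary.AllPairs as AllPairs using (AllPairs; []; _∷_)
import Data.List.Relation.Unary.AllPairs.Properties as AllPairsP
open import Data.List.Relation.Binary.Sublist.Propositional using (_⊆_; []; _∷_; _∷ʳ_)
open import Data.List.Relation.Binary.Sublist.Propositional.Properties using (All-resp-⊆)
open import Data.List.Membership.Propositional using (_∈_)
open import Data.List.Membership.Propositional.Properties using (∈-allFin; ∈-filter⁺)
open import Data.Product using (Σ-syntax; _×_; _,_; proj₁; proj₂)
open import Data.Sum using (inj₁; inj₂)
open import Data.Unit using (⊤; tt)
open import Data.Empty as Empty using ()
open import Data.Integer as ℤ using (ℤ)
import Data.Integer.Properties as ℤP
open import Data.Rational as ℚ using (ℚ; 0ℚ; 1ℚ; _+_; _*_; _-_; _<_)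
import Data.Rational.Properties as ℚP
open import Algebra.Bundles using (CommutativeMonoid)
open import Algebra.Properties.CommutativeSemigroup
  (CommutativeMonoid.commutativeSemigroup ℚP.*-1-commutativeMonoid)
  using () renaming (interchange to *-interchange)
open import Data.Rational.Unnormalised as ℚᵘ using (mkℚᵘ; *≡*)
import Data.Rational.Unnormalised.Properties as ℚᵘP
import Data.Rational.Solver as ℚSolver
import Data.Integer.Solver as ℤSolver
open import Function using (_∘_; id; Equivalence; mk⇔)
open import Relation.Binary.PropositionalEquality hiding ([_])
open import Relation.Nullary using (Dec; yes; no; does)
open import Relation.Nullary.Decidable using (dec-true; dec-false; T?; does-⇔)

[_] : Bool → ℕ
[ true ]  = 1
[ false ] = 0

∑ : {A : Set} → (A → ℕ) → List A → ℕ
∑ f []       = 0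
∑ f (x ∷ xs) = f x ℕ.+ ∑ f xs

count : {A : Set} → (A → Bool) → List A → ℕ
count p xs = length (filterᵇ p xs)

true≢false : true ≢ false
true≢false ()

∧≡true⇒ : ∀ {x y} → (x ∧ y) ≡ true → x ≡ true × y ≡ true
∧≡true⇒ {true} y≡true = refl , y≡true

∨≡false⇒ : ∀ {x y} → (x ∨ y) ≡ false → x ≡ false × y ≡ false
∨≡false⇒ {false} y≡false = refl , y≡false

not≡true⇒ : ∀ {x} → not x ≡ true → x ≡ false
not≡true⇒ {false} _ = refl

does≡true⇒ : {P : Set} (P? : Dec P) → does P? ≡ true → P
does≡true⇒ (yes p) _ = p

T⇒≡true : ∀ {b} → T b → b ≡ true
T⇒≡true = Equivalence.to BP.T-≡

≡true⇒T : ∀ {b} → b ≡ true → T b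
≡true⇒T = Equivalence.from BP.T-≡

count≡∑ : {A : Set} (p : A → Bool) (xs : List A) → count p xs ≡ ∑ (λ x → [ p x ]) xs
count≡∑ p [] = refl
count≡∑ p (x ∷ xs) with p x
... | true  = cong suc (count≡∑ p xs)
... | false = count≡∑ p xs

∑-++ : {A : Set} (f : A → ℕ) (xs ys : List A) → ∑ f (xs ++ ys) ≡ ∑ f xs ℕ.+ ∑ f ys
∑-++ f [] ys = refl
∑-++ f (x ∷ xs) ys = trans (cong (f x ℕ.+_) (∑-++ f xs ys)) (sym (ℕP.+-assoc (f x) _ _))

∑-congᴬ : {A : Set} {f g : A → ℕ} (xs : List A) → All (λ x → f x ≡ g x) xs → ∑ f xs ≡ ∑ g xs
∑-congᴬ [] [] = refl
∑-congᴬ (x ∷ xs) (e ∷ es) = cong₂ ℕ._+_ e (∑-congᴬ xs es)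

∑-cong : {A : Set} {f g : A → ℕ} (xs : List A) → (∀ x → f x ≡ g x) → ∑ f xs ≡ ∑ g xs
∑-cong xs e = ∑-congᴬ xs (All.tabulate (λ {x} _ → e x))

∑-zeroᴬ : {A : Set} {f : A → ℕ} (xs : List A) → All (λ x → f x ≡ 0) xs → ∑ f xs ≡ 0
∑-zeroᴬ [] [] = refl
∑-zeroᴬ (x ∷ xs) (e ∷ es) rewrite e = ∑-zeroᴬ xs es

∑-+ : {A : Set} (f g : A → ℕ) (xs : List A) → ∑ (λ x → f x ℕ.+ g x) xs ≡ ∑ f xs ℕ.+ ∑ g xs
∑-+ f g [] = refl
∑-+ f g (x ∷ xs) rewrite ∑-+ f g xs = +-interchange (f x) (g x) (∑ f xs) (∑ g xs)

∑-*ˡ : {A : Set} (c : ℕ) (f : A → ℕ) (xs : List A) → ∑ (λ x → c ℕ.* f x) xs ≡ c ℕ.* ∑ f xs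
∑-*ˡ c f [] = sym (ℕP.*-zeroʳ c)
∑-*ˡ c f (x ∷ xs) rewrite ∑-*ˡ c f xs = sym (ℕP.*-distribˡ-+ c (f x) (∑ f xs))

∑-swap : {A B : Set} (f : A → B → ℕ) (xs : List A) (ys : List B) →
  ∑ (λ y → ∑ (λ x → f x y) xs) ys ≡ ∑ (λ x → ∑ (λ y → f x y) ys) xs
∑-swap f [] ys = ∑-zeroᴬ ys (All.tabulate (λ _ → refl))
∑-swap f (x ∷ xs) ys =
  trans (∑-+ (f x) (λ y → ∑ (λ x → f x y) xs) ys) (cong (∑ (f x) ys ℕ.+_) (∑-swap f xs ys))

∑-filter : {A : Set} (f : A → ℕ) (q : A → Bool) (xs : List A) →
  ∑ f (filterᵇ q xs) ≡ ∑ (λ x → if q x then f x else 0) xs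
∑-filter f q [] = refl
∑-filter f q (x ∷ xs) with q x
... | true  = cong (f x ℕ.+_) (∑-filter f q xs)
... | false = ∑-filter f q xs

∑-≥ : {A : Set} (f : A → ℕ) {x : A} (xs : List A) → x ∈ xs → f x ≤ ∑ f xs
∑-≥ f (y ∷ xs) (here refl) = ℕP.m≤m+n (f y) _
∑-≥ f (y ∷ xs) (there x∈xs) = ℕP.≤-trans (∑-≥ f xs x∈xs) (ℕP.m≤n+m _ (f y))

[∧] : ∀ x y → [ x ∧ y ] ≡ [ x ] ℕ.* [ y ]
[∧] true y = sym (ℕP.+-identityʳ [ y ])
[∧] false y = refl

count-++ : {A : Set} (p : A → Bool) (xs ys : List A) → count p (xs ++ ys) ≡ count p xs ℕ.+ count p ys
count-++ p xs ys = trans (count≡∑ p (xs ++ ys)) (trans (∑-++ _ xs ys) (sym (cong₂ ℕ._+_ (count≡∑ p xs) (count≡∑ p ys))))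

count-map : {A B : Set} (p : B → Bool) (f : A → B) (xs : List A) → count p (map f xs) ≡ count (p ∘ f) xs
count-map p f [] = refl
count-map p f (x ∷ xs) with p (f x)
... | true  = cong suc (count-map p f xs)
... | false = count-map p f xs

count-congᴬ : {A : Set} {p q : A → Bool} (xs : List A) → All (λ x → p x ≡ q x) xs → count p xs ≡ count q xs
count-congᴬ {p = p} xs es = trans (count≡∑ p xs) (trans (∑-congᴬ xs (All.map (cong [_]) es)) (sym (count≡∑ _ xs)))

count-cong : {A : Set} {p q : A → Bool} (xs : List A) → (∀ x → p x ≡ q x) → count p xs ≡ count q xs
count-cong xs e = count-congᴬ xs (All.tabulate (λ {x} _ → e x))

count-split : {A : Set} (p q : A → Bool) (xs : List A) →
  count p xs ≡ count (λ x → p x ∧ q x) xs ℕ.+ count (λ x → p x ∧ not (q x)) xs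
count-split p q [] = refl
count-split p q (x ∷ xs) with p x | q x
... | true  | true  = cong suc (count-split p q xs)
... | true  | false = trans (cong suc (count-split p q xs)) (sym (ℕP.+-suc _ _))
... | false | _     = count-split p q xs

count-positive : {A : Set} (p : A → Bool) (xs : List A) → 0 ℕ.< count p xs → Σ[ x ∈ A ] p x ≡ true
count-positive p (x ∷ xs) h with p x in px
... | true  = x , px
... | false = count-positive p xs h

count-false : {A : Set} (xs : List A) → count (λ _ → false) xs ≡ 0
count-false [] = refl
count-false (x ∷ xs) = count-false xs

filterᵇ-filterᵇ : {A : Set} (p q : A → Bool) (xs : List A) → filterᵇ p (filterᵇ q xs) ≡ filterᵇ (λ x → q x ∧ p x) xs
filterᵇ-filterᵇ p q [] = refl
filterᵇ-filterᵇ p q (x ∷ xs) with q x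
... | false = filterᵇ-filterᵇ p q xs
... | true with p x
...   | true  = cong (x ∷_) (filterᵇ-filterᵇ p q xs)
...   | false = filterᵇ-filterᵇ p q xs

∈-filterᵇ⁺ : {A : Set} (p : A → Bool) {x : A} {xs : List A} → x ∈ xs → p x ≡ true → x ∈ filterᵇ p xs
∈-filterᵇ⁺ p x∈xs px = ∈-filter⁺ (T? ∘ p) x∈xs (≡true⇒T px)

all-filterᵇ : {A : Set} (p : A → Bool) (xs : List A) → All (λ x → p x ≡ true) (filterᵇ p xs)
all-filterᵇ p xs = All.map T⇒≡true (AllP.all-filter (T? ∘ p) xs)

fromℕ : ℕ → ℚ
fromℕ m = toℚ (ℤ.+ m)

private
  toℚᵘ-fromℕ : ∀ m → ℚ.toℚᵘ (fromℕ m) ℚᵘ.≃ mkℚᵘ (ℤ.+ m) 0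
  toℚᵘ-fromℕ m = ℚP.toℚᵘ-fromℚᵘ (mkℚᵘ (ℤ.+ m) 0)

  toℚᵘ-frac : ∀ m q → ℚ.toℚᵘ (frac m (suc q)) ℚᵘ.≃ mkℚᵘ (ℤ.+ m) q
  toℚᵘ-frac m q = ℚP.toℚᵘ-fromℚᵘ (mkℚᵘ (ℤ.+ m) q)

fromℕ-+ : ∀ m n → fromℕ (m ℕ.+ n) ≡ fromℕ m + fromℕ n
fromℕ-+ m n = ℚP.toℚᵘ-injective (ℚᵘP.≃-trans (toℚᵘ-fromℕ (m ℕ.+ n)) (ℚᵘP.≃-sym
  (ℚᵘP.≃-trans (ℚP.toℚᵘ-homo-+ (fromℕ m) (fromℕ n))
  (ℚᵘP.≃-trans (ℚᵘP.+-cong (toℚᵘ-fromℕ m) (toℚᵘ-fromℕ n)) (*≡* cross)))))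
  where
  cross : (ℤ.+ m ℤ.* ℤ.+ 1 ℤ.+ ℤ.+ n ℤ.* ℤ.+ 1) ℤ.* ℤ.+ 1 ≡ ℤ.+ (m ℕ.+ n) ℤ.* ℤ.+ (1 ℕ.* 1)
  cross rewrite ℤP.*-identityʳ (ℤ.+ m) | ℤP.*-identityʳ (ℤ.+ n) | ℤP.*-identityʳ (ℤ.+ m ℤ.+ ℤ.+ n)
    = sym (ℤP.pos-+ m n)

fromℕ-* : ∀ m n → fromℕ (m ℕ.* n) ≡ fromℕ m * fromℕ n
fromℕ-* m n = ℚP.toℚᵘ-injective (ℚᵘP.≃-trans (toℚᵘ-fromℕ (m ℕ.* n)) (ℚᵘP.≃-sym
  (ℚᵘP.≃-trans (ℚP.toℚᵘ-homo-* (fromℕ m) (fromℕ n))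
  (ℚᵘP.≃-trans (ℚᵘP.*-cong (toℚᵘ-fromℕ m) (toℚᵘ-fromℕ n)) (*≡* cross)))))
  where
  cross : (ℤ.+ m ℤ.* ℤ.+ n) ℤ.* ℤ.+ 1 ≡ ℤ.+ (m ℕ.* n) ℤ.* ℤ.+ (1 ℕ.* 1)
  cross rewrite ℤP.*-identityʳ (ℤ.+ m ℤ.* ℤ.+ n) | ℤP.*-identityʳ (ℤ.+ (m ℕ.* n)) = sym (ℤP.pos-* m n)

fromℕ-injective : ∀ {m n} → fromℕ m ≡ fromℕ n → m ≡ n
fromℕ-injective {m} {n} e with ℚᵘP.≃-trans (ℚᵘP.≃-sym (toℚᵘ-fromℕ m)) (ℚᵘP.≃-trans (ℚP.toℚᵘ-cong e) (toℚᵘ-fromℕ n))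
... | *≡* m≡n rewrite ℤP.*-identityʳ (ℤ.+ m) | ℤP.*-identityʳ (ℤ.+ n) = ℤP.+-injective m≡n

fromℕ≢0 : ∀ {m} → m ≢ 0 → fromℕ m ≢ 0ℚ
fromℕ≢0 m≢0 e = m≢0 (fromℕ-injective e)

*-inv : ∀ q → q ≢ 0ℚ → q * inv q ≡ 1ℚ
*-inv q q≢0 with q ℚP.≟ 0ℚ
... | yes q≡0 = Empty.⊥-elim (q≢0 q≡0)
... | no q≢0′ = ℚP.*-inverseʳ q {{ℚ.≢-nonZero q≢0′}}

inv-unique : ∀ x y → x * y ≡ 1ℚ → x ≡ inv y
inv-unique x y xy≡1 = by-cases (y ℚP.≟ 0ℚ)
  where
  by-cases : Dec (y ≡ 0ℚ) → x ≡ inv y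
  by-cases (yes refl) = Empty.⊥-elim (ℚP.1≢0 (trans (sym xy≡1) (ℚP.*-zeroʳ x)))
  by-cases (no y≢0) = begin
    x                ≡⟨ sym (ℚP.*-identityʳ x) ⟩
    x * 1ℚ           ≡⟨ cong (x *_) (sym (*-inv y y≢0)) ⟩
    x * (y * inv y)  ≡⟨ sym (ℚP.*-assoc x y (inv y)) ⟩
    (x * y) * inv y  ≡⟨ cong (_* inv y) xy≡1 ⟩
    1ℚ * inv y       ≡⟨ ℚP.*-identityˡ (inv y) ⟩
    inv y            ∎
    where open ≡-Reasoning

inv-* : ∀ x y → inv (x * y) ≡ inv x * inv y
inv-* x y = by-cases (x ℚP.≟ 0ℚ) (y ℚP.≟ 0ℚ)
  where
  by-cases : Dec (x ≡ 0ℚ) → Dec (y ≡ 0ℚ) → inv (x * y) ≡ inv x * inv y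
  by-cases (yes refl) _ = trans (cong inv (ℚP.*-zeroˡ y)) (sym (ℚP.*-zeroˡ (inv y)))
  by-cases (no _) (yes refl) = trans (cong inv (ℚP.*-zeroʳ x)) (sym (ℚP.*-zeroʳ (inv x)))
  by-cases (no x≢0) (no y≢0) = sym (inv-unique (inv x * inv y) (x * y) (begin
    (inv x * inv y) * (x * y) ≡⟨ ℚP.*-comm (inv x * inv y) (x * y) ⟩
    (x * y) * (inv x * inv y) ≡⟨ *-interchange x y (inv x) (inv y) ⟩
    (x * inv x) * (y * inv y) ≡⟨ cong₂ _*_ (*-inv x x≢0) (*-inv y y≢0) ⟩
    1ℚ                        ∎))
    where open ≡-Reasoning

inv-involutive : ∀ x → inv (inv x) ≡ x
inv-involutive x = by-cases (x ℚP.≟ 0ℚ)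
  where
  by-cases : Dec (x ≡ 0ℚ) → inv (inv x) ≡ x
  by-cases (yes refl) = refl
  by-cases (no x≢0) = sym (inv-unique x (inv x) (*-inv x x≢0))

private
  frac-*-denominator : ∀ a q → frac a (suc q) * fromℕ (suc q) ≡ fromℕ a
  frac-*-denominator a q = ℚP.toℚᵘ-injective (ℚᵘP.≃-trans (ℚP.toℚᵘ-homo-* (frac a (suc q)) (fromℕ (suc q)))
    (ℚᵘP.≃-trans (ℚᵘP.*-cong (toℚᵘ-frac a q) (toℚᵘ-fromℕ (suc q)))
    (ℚᵘP.≃-trans (*≡* cross) (ℚᵘP.≃-sym (toℚᵘ-fromℕ a)))))
    where
    cross : (ℤ.+ a ℤ.* ℤ.+ suc q) ℤ.* ℤ.+ 1 ≡ ℤ.+ a ℤ.* ℤ.+ (suc q ℕ.* 1)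
    cross rewrite ℤP.*-identityʳ (ℤ.+ a ℤ.* ℤ.+ suc q) | ℕP.*-identityʳ q = refl

frac≡*inv : ∀ a c → frac a c ≡ fromℕ a * inv (fromℕ c)
frac≡*inv a zero = sym (ℚP.*-zeroʳ (fromℕ a))
frac≡*inv a (suc q) = begin
  frac a (suc q)                                ≡⟨ sym (ℚP.*-identityʳ _) ⟩
  frac a (suc q) * 1ℚ                           ≡⟨ cong (frac a (suc q) *_) (sym (*-inv c (fromℕ≢0 {suc q} (λ ())))) ⟩
  frac a (suc q) * (c * inv c)                  ≡⟨ sym (ℚP.*-assoc (frac a (suc q)) c (inv c)) ⟩
  (frac a (suc q) * c) * inv c                  ≡⟨ cong (_* inv c) (frac-*-denominator a q) ⟩
  fromℕ a * inv c                               ∎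
  where
  open ≡-Reasoning
  c = fromℕ (suc q)

frac-0ˡ : ∀ c → frac 0 c ≡ 0ℚ
frac-0ˡ zero = refl
frac-0ˡ (suc c) = ℚP.0/n≡0 (suc c)

frac-self : ∀ c → c ≢ 0 → frac c c ≡ 1ℚ
frac-self c c≢0 = trans (frac≡*inv c c) (*-inv (fromℕ c) (fromℕ≢0 c≢0))

frac-+ : ∀ a b c → frac a c + frac b c ≡ frac (a ℕ.+ b) c
frac-+ a b c = begin
  frac a c + frac b c                           ≡⟨ cong₂ _+_ (frac≡*inv a c) (frac≡*inv b c) ⟩
  fromℕ a * inv (fromℕ c) + fromℕ b * inv (fromℕ c) ≡⟨ sym (ℚP.*-distribʳ-+ (inv (fromℕ c)) (fromℕ a) (fromℕ b)) ⟩
  (fromℕ a + fromℕ b) * inv (fromℕ c)           ≡⟨ cong (_* inv (fromℕ c)) (sym (fromℕ-+ a b)) ⟩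
  fromℕ (a ℕ.+ b) * inv (fromℕ c)               ≡⟨ sym (frac≡*inv (a ℕ.+ b) c) ⟩
  frac (a ℕ.+ b) c                              ∎
  where open ≡-Reasoning

private
  x+y-x≡y : ∀ x y → (x + y) - x ≡ y
  x+y-x≡y = solve 2 (λ x y → (x :+ y) :- x := y) refl
    where open ℚSolver.+-*-Solver

frac-∸ : ∀ a b c → frac (a ℕ.+ b) c - frac a c ≡ frac b c
frac-∸ a b c = trans (cong (_- frac a c) (sym (frac-+ a b c))) (x+y-x≡y (frac a c) (frac b c))

1-frac : ∀ a b c → c ≡ a ℕ.+ b → c ≢ 0 → 1ℚ - frac a c ≡ frac b c
1-frac a b c c≡a+b c≢0 = begin
  1ℚ - frac a c                  ≡⟨ cong (_- frac a c) (sym (frac-self c c≢0)) ⟩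
  frac c c - frac a c            ≡⟨ cong (λ x → frac x c - frac a c) c≡a+b ⟩
  frac (a ℕ.+ b) c - frac a c    ≡⟨ frac-∸ a b c ⟩
  frac b c                       ∎
  where open ≡-Reasoning

inv-frac : ∀ a c → inv (frac a c) ≡ frac c a
inv-frac a c = begin
  inv (frac a c)                         ≡⟨ cong inv (frac≡*inv a c) ⟩
  inv (fromℕ a * inv (fromℕ c))          ≡⟨ inv-* (fromℕ a) (inv (fromℕ c)) ⟩
  inv (fromℕ a) * inv (inv (fromℕ c))    ≡⟨ cong (inv (fromℕ a) *_) (inv-involutive (fromℕ c)) ⟩
  inv (fromℕ a) * fromℕ c                ≡⟨ ℚP.*-comm (inv (fromℕ a)) (fromℕ c) ⟩
  fromℕ c * inv (fromℕ a)                ≡⟨ sym (frac≡*inv c a) ⟩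
  frac c a                               ∎
  where open ≡-Reasoning

frac-telescope : ∀ a b c → b ≢ 0 → frac b c * frac a b ≡ frac a c
frac-telescope a b c b≢0 = begin
  frac b c * frac a b                                        ≡⟨ cong₂ _*_ (frac≡*inv b c) (frac≡*inv a b) ⟩
  (fromℕ b * inv (fromℕ c)) * (fromℕ a * inv (fromℕ b))      ≡⟨ rearrange (fromℕ b) (inv (fromℕ c)) (fromℕ a) (inv (fromℕ b)) ⟩
  (fromℕ a * inv (fromℕ c)) * (fromℕ b * inv (fromℕ b))      ≡⟨ cong ((fromℕ a * inv (fromℕ c)) *_) (*-inv (fromℕ b) (fromℕ≢0 b≢0)) ⟩
  (fromℕ a * inv (fromℕ c)) * 1ℚ                             ≡⟨ ℚP.*-identityʳ _ ⟩
  fromℕ a * inv (fromℕ c)                                    ≡⟨ sym (frac≡*inv a c) ⟩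
  frac a c                                                   ∎
  where
  open ≡-Reasoning
  open ℚSolver.+-*-Solver
  rearrange : ∀ b c′ a b′ → (b * c′) * (a * b′) ≡ (a * c′) * (b * b′)
  rearrange = solve 4 (λ b c′ a b′ → (b :* c′) :* (a :* b′) := (a :* c′) :* (b :* b′)) refl

private
  frac-*-1-frac-nonzero : ∀ a b c → a ℕ.+ b ≢ 0 → frac (a ℕ.+ b) c * (1ℚ - frac a (a ℕ.+ b)) ≡ frac b c
  frac-*-1-frac-nonzero a b c a+b≢0 =
    trans (cong (frac (a ℕ.+ b) c *_) (1-frac a b (a ℕ.+ b) refl a+b≢0)) (frac-telescope b (a ℕ.+ b) c a+b≢0)

-- Also true when a + b = 0, since frac _ 0 = 0: in part (b) the count 𝒩(d − e_{B ∪ {v}}) may vanish.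
frac-*-1-frac : ∀ a b c → frac (a ℕ.+ b) c * (1ℚ - frac a (a ℕ.+ b)) ≡ frac b c
frac-*-1-frac zero zero c =
  trans (cong (_* (1ℚ - frac 0 0)) (frac-0ˡ c)) (trans (ℚP.*-zeroˡ (1ℚ - frac 0 0)) (sym (frac-0ˡ c)))
frac-*-1-frac zero (suc b) c = frac-*-1-frac-nonzero zero (suc b) c (λ ())
frac-*-1-frac (suc a) b c = frac-*-1-frac-nonzero (suc a) b c (λ ())

inv-fromℕ-*-frac : ∀ m a c → inv (fromℕ m) * frac a c ≡ frac a (m ℕ.* c)
inv-fromℕ-*-frac m a c = begin
  inv (fromℕ m) * frac a c                       ≡⟨ cong (inv (fromℕ m) *_) (frac≡*inv a c) ⟩
  inv (fromℕ m) * (fromℕ a * inv (fromℕ c))      ≡⟨ ℚP.*-comm (inv (fromℕ m)) _ ⟩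
  (fromℕ a * inv (fromℕ c)) * inv (fromℕ m)      ≡⟨ ℚP.*-assoc (fromℕ a) _ _ ⟩
  fromℕ a * (inv (fromℕ c) * inv (fromℕ m))      ≡⟨ cong (fromℕ a *_) (sym (inv-* (fromℕ c) (fromℕ m))) ⟩
  fromℕ a * inv (fromℕ c * fromℕ m)              ≡⟨ cong (λ x → fromℕ a * inv x) (sym (fromℕ-* c m)) ⟩
  fromℕ a * inv (fromℕ (c ℕ.* m))                ≡⟨ sym (frac≡*inv a (c ℕ.* m)) ⟩
  frac a (c ℕ.* m)                               ≡⟨ cong (frac a) (ℕP.*-comm c m) ⟩
  frac a (m ℕ.* c)                               ∎
  where open ≡-Reasoning

fromℕ-*-frac : ∀ m a c → m ≢ 0 → fromℕ m * frac a (m ℕ.* c) ≡ frac a c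
fromℕ-*-frac m a c m≢0 = begin
  fromℕ m * frac a (m ℕ.* c)               ≡⟨ cong (fromℕ m *_) (sym (inv-fromℕ-*-frac m a c)) ⟩
  fromℕ m * (inv (fromℕ m) * frac a c)     ≡⟨ sym (ℚP.*-assoc (fromℕ m) (inv (fromℕ m)) (frac a c)) ⟩
  (fromℕ m * inv (fromℕ m)) * frac a c     ≡⟨ cong (_* frac a c) (*-inv (fromℕ m) (fromℕ≢0 m≢0)) ⟩
  1ℚ * frac a c                            ≡⟨ ℚP.*-identityˡ (frac a c) ⟩
  frac a c                                 ∎
  where open ≡-Reasoning

frac-rescale : ∀ p q a c → p ≢ 0 → q ≢ 0 → (fromℕ p * inv (fromℕ q)) * frac (q ℕ.* a) (p ℕ.* c) ≡ frac a c
frac-rescale p q a c p≢0 q≢0 = begin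
  (P′ * inv Q′) * frac (q ℕ.* a) (p ℕ.* c)                    ≡⟨ cong ((P′ * inv Q′) *_) (frac≡*inv (q ℕ.* a) (p ℕ.* c)) ⟩
  (P′ * inv Q′) * (fromℕ (q ℕ.* a) * inv (fromℕ (p ℕ.* c)))  ≡⟨ cong₂ (λ x y → (P′ * inv Q′) * (x * inv y)) (fromℕ-* q a) (fromℕ-* p c) ⟩
  (P′ * inv Q′) * ((Q′ * A′) * inv (P′ * C′))                 ≡⟨ cong (λ x → (P′ * inv Q′) * ((Q′ * A′) * x)) (inv-* P′ C′) ⟩
  (P′ * inv Q′) * ((Q′ * A′) * (inv P′ * inv C′))             ≡⟨ rearrange P′ (inv P′) Q′ (inv Q′) A′ (inv C′) ⟩
  ((P′ * inv P′) * (Q′ * inv Q′)) * (A′ * inv C′)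
    ≡⟨ cong₂ (λ x y → (x * y) * (A′ * inv C′)) (*-inv P′ (fromℕ≢0 p≢0)) (*-inv Q′ (fromℕ≢0 q≢0)) ⟩
  (1ℚ * 1ℚ) * (A′ * inv C′)                                   ≡⟨ ℚP.*-identityˡ (A′ * inv C′) ⟩
  A′ * inv C′                                                 ≡⟨ sym (frac≡*inv a c) ⟩
  frac a c                                                    ∎
  where
  open ≡-Reasoning
  open ℚSolver.+-*-Solver
  P′ Q′ A′ C′ : ℚ
  P′ = fromℕ p
  Q′ = fromℕ q
  A′ = fromℕ a
  C′ = fromℕ c
  rearrange : ∀ p p′ q q′ a c′ → (p * q′) * ((q * a) * (p′ * c′)) ≡ ((p * p′) * (q * q′)) * (a * c′)
  rearrange = solve 6 (λ p p′ q q′ a c′ → (p :* q′) :* ((q :* a) :* (p′ :* c′)) := ((p :* p′) :* (q :* q′)) :* (a :* c′)) refl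

sumℚ-frac : {A : Set} (f : A → ℕ) (c : ℕ) (xs : List A) →
  sumℚ (map (λ x → frac (f x) c) xs) ≡ frac (∑ f xs) c
sumℚ-frac f c [] = sym (frac-0ˡ c)
sumℚ-frac f c (x ∷ xs) = trans (cong (frac (f x) c +_) (sumℚ-frac f c xs)) (frac-+ (f x) _ c)

frac≢0⇒numerator≢0 : ∀ a c → frac a c ≢ 0ℚ → a ≢ 0
frac≢0⇒numerator≢0 a c frac≢0 refl = frac≢0 (frac-0ˡ c)

frac≢0⇒denominator≢0 : ∀ a c → frac a c ≢ 0ℚ → c ≢ 0
frac≢0⇒denominator≢0 a c frac≢0 refl = frac≢0 refl

mem-∪ : ∀ {n} (s t : Subset n) i → memᵇ i (s ∪ t) ≡ (memᵇ i s ∨ memᵇ i t)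
mem-∪ s t i = VP.lookup-zipWith _∨_ i s t

mem-⊥ : ∀ {n} (i : Fin n) → memᵇ i ⊥ ≡ false
mem-⊥ i = VP.lookup-replicate i false

mem-⁅⁆ : ∀ {n} (a i : Fin n) → memᵇ i ⁅ a ⁆ ≡ does (a FP.≟ i)
mem-⁅⁆ zero    zero    = refl
mem-⁅⁆ zero    (suc i) = mem-⊥ i
mem-⁅⁆ (suc a) zero    = refl
mem-⁅⁆ (suc a) (suc i) with a FP.≟ i
... | yes refl = trans (mem-⁅⁆ a a) (dec-true (a FP.≟ a) refl)
... | no a≢i  = trans (mem-⁅⁆ a i) (dec-false (a FP.≟ i) a≢i)

mem-⁅⁆-self : ∀ {n} (a : Fin n) → memᵇ a ⁅ a ⁆ ≡ true
mem-⁅⁆-self a = trans (mem-⁅⁆ a a) (dec-true (a FP.≟ a) refl)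

mem-⁅⁆-other : ∀ {n} (a i : Fin n) → a ≢ i → memᵇ i ⁅ a ⁆ ≡ false
mem-⁅⁆-other a i a≢i = trans (mem-⁅⁆ a i) (dec-false (a FP.≟ i) a≢i)

mem-∪⁅⁆ : ∀ {n} (a i : Fin n) s → memᵇ i (s ∪ ⁅ a ⁆) ≡ (memᵇ i s ∨ does (a FP.≟ i))
mem-∪⁅⁆ a i s = trans (mem-∪ s ⁅ a ⁆ i) (cong (memᵇ i s ∨_) (mem-⁅⁆ a i))

mem-∪⁅⁆-self : ∀ {n} (a : Fin n) s → memᵇ a (s ∪ ⁅ a ⁆) ≡ true
mem-∪⁅⁆-self a s rewrite mem-∪ s ⁅ a ⁆ a | mem-⁅⁆-self a = BP.∨-zeroʳ _

∉⇒memᵇ≡false : ∀ {n} {a : Fin n} {K : Subset n} → a ∉ K → memᵇ a K ≡ false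
∉⇒memᵇ≡false {a = a} {K} a∉K with lookup K a in e
... | true  = Empty.⊥-elim (a∉K (VP.lookup⇒[]= a K e))
... | false = refl

memᵇ≡false⇒∉ : ∀ {n} {a : Fin n} {K : Subset n} → memᵇ a K ≡ false → a ∉ K
memᵇ≡false⇒∉ e a∈K with trans (sym (VP.[]=⇒lookup a∈K)) e
... | ()

subset-ext : ∀ {n} {s t : Subset n} → (∀ i → memᵇ i s ≡ memᵇ i t) → s ≡ t
subset-ext {s = []} {[]} e = refl
subset-ext {s = x ∷ s} {y ∷ t} e = cong₂ _∷_ (e zero) (subset-ext (λ i → e (suc i)))

remove : ∀ {n} → Fin n → Subset n → Subset n
remove zero    (x ∷ s) = false ∷ s
remove (suc a) (x ∷ s) = x ∷ remove a s

mem-remove-self : ∀ {n} (a : Fin n) s → memᵇ a (remove a s) ≡ false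
mem-remove-self zero    (x ∷ s) = refl
mem-remove-self (suc a) (x ∷ s) = mem-remove-self a s

mem-remove-other : ∀ {n} (a i : Fin n) s → a ≢ i → memᵇ i (remove a s) ≡ memᵇ i s
mem-remove-other zero    zero    s       a≢i = Empty.⊥-elim (a≢i refl)
mem-remove-other zero    (suc i) (x ∷ s) a≢i = refl
mem-remove-other (suc a) zero    (x ∷ s) a≢i = refl
mem-remove-other (suc a) (suc i) (x ∷ s) a≢i = mem-remove-other a i s (a≢i ∘ cong suc)

mem-remove : ∀ {n} (a i : Fin n) s → memᵇ i (remove a s) ≡ (not (does (a FP.≟ i)) ∧ memᵇ i s)
mem-remove a i s with a FP.≟ i
... | yes refl = mem-remove-self a s
... | no a≢i  = mem-remove-other a i s a≢i

∣remove∣-∈ : ∀ {n} (a : Fin n) s → memᵇ a s ≡ true → ∣ s ∣ ≡ suc ∣ remove a s ∣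
∣remove∣-∈ zero    (true ∷ s)  e = refl
∣remove∣-∈ (suc a) (true ∷ s)  e = cong suc (∣remove∣-∈ a s e)
∣remove∣-∈ (suc a) (false ∷ s) e = ∣remove∣-∈ a s e

∣remove∣-∉ : ∀ {n} (a : Fin n) s → memᵇ a s ≡ false → ∣ s ∣ ≡ ∣ remove a s ∣
∣remove∣-∉ zero    (false ∷ s) e = refl
∣remove∣-∉ (suc a) (true ∷ s)  e = cong suc (∣remove∣-∉ a s e)
∣remove∣-∉ (suc a) (false ∷ s) e = ∣remove∣-∉ a s e

remove-∪⁅⁆ : ∀ {n} (a : Fin n) K → a ∉ K → remove a (K ∪ ⁅ a ⁆) ≡ K
remove-∪⁅⁆ a K a∉K = subset-ext pointwise
  where
  pointwise : ∀ i → memᵇ i (remove a (K ∪ ⁅ a ⁆)) ≡ memᵇ i K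
  pointwise i rewrite mem-remove a i (K ∪ ⁅ a ⁆) | mem-∪⁅⁆ a i K with a FP.≟ i
  ... | yes refl = sym (∉⇒memᵇ≡false a∉K)
  ... | no _     = BP.∨-identityʳ _

∪⁅⁆-remove : ∀ {n} (a : Fin n) s → memᵇ a s ≡ true → remove a s ∪ ⁅ a ⁆ ≡ s
∪⁅⁆-remove a s a∈s = subset-ext pointwise
  where
  pointwise : ∀ i → memᵇ i (remove a s ∪ ⁅ a ⁆) ≡ memᵇ i s
  pointwise i rewrite mem-∪⁅⁆ a i (remove a s) | mem-remove a i s with a FP.≟ i
  ... | yes refl = sym a∈s
  ... | no _     = BP.∨-identityʳ _

∣∪⁅⁆∣ : ∀ {n} (a : Fin n) K → a ∉ K → ∣ K ∪ ⁅ a ⁆ ∣ ≡ suc ∣ K ∣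
∣∪⁅⁆∣ a K a∉K = trans (∣remove∣-∈ a (K ∪ ⁅ a ⁆) (mem-∪⁅⁆-self a K)) (cong (suc ∘ ∣_∣) (remove-∪⁅⁆ a K a∉K))

eqSub-refl : ∀ {n} (s : Subset n) → eqSub s s ≡ true
eqSub-refl [] = refl
eqSub-refl (true ∷ s) = eqSub-refl s
eqSub-refl (false ∷ s) = eqSub-refl s

eqSub-sym : ∀ {n} (s t : Subset n) → eqSub s t ≡ eqSub t s
eqSub-sym [] [] = refl
eqSub-sym (true ∷ s) (true ∷ t) = eqSub-sym s t
eqSub-sym (true ∷ s) (false ∷ t) = refl
eqSub-sym (false ∷ s) (true ∷ t) = refl
eqSub-sym (false ∷ s) (false ∷ t) = eqSub-sym s t

eqSub⇒≡ : ∀ {n} (s t : Subset n) → eqSub s t ≡ true → s ≡ t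
eqSub⇒≡ [] [] e = refl
eqSub⇒≡ (true ∷ s) (true ∷ t) e = cong (true ∷_) (eqSub⇒≡ s t e)
eqSub⇒≡ (false ∷ s) (false ∷ t) e = cong (false ∷_) (eqSub⇒≡ s t e)

≢⇒eqSub≡false : ∀ {n} (s t : Subset n) → s ≢ t → eqSub s t ≡ false
≢⇒eqSub≡false s t s≢t with eqSub s t in e
... | true  = Empty.⊥-elim (s≢t (eqSub⇒≡ s t e))
... | false = refl

eqSub-ext : ∀ {n} (s t : Subset n) → (∀ i → memᵇ i s ≡ memᵇ i t) → eqSub s t ≡ true
eqSub-ext s t e = subst (λ u → eqSub s u ≡ true) (subset-ext e) (eqSub-refl s)

eqSub-separated : ∀ {n} (s t : Subset n) i → memᵇ i s ≡ true → memᵇ i t ≡ false → eqSub s t ≡ false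
eqSub-separated s t i i∈s i∉t = ≢⇒eqSub≡false s t (λ s≡t → true≢false (trans (sym i∈s) (trans (cong (memᵇ i) s≡t) i∉t)))

eqSub-separated′ : ∀ {n} (s t : Subset n) i → memᵇ i s ≡ false → memᵇ i t ≡ true → eqSub s t ≡ false
eqSub-separated′ s t i i∉s i∈t = trans (eqSub-sym s t) (eqSub-separated t s i i∈t i∉s)

Distinct : ∀ {n} → List (Subset n) → Set
Distinct = AllPairs (λ s t → eqSub s t ≡ false)

AllPairs-resp-⊆ : {A : Set} {R : A → A → Set} {xs ys : List A} → xs ⊆ ys → AllPairs R ys → AllPairs R xs
AllPairs-resp-⊆ [] [] = []
AllPairs-resp-⊆ (y ∷ʳ xs⊆ys) (_ ∷ Rys) = AllPairs-resp-⊆ xs⊆ys Rys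
AllPairs-resp-⊆ (refl ∷ xs⊆ys) (Ry ∷ Rys) = All-resp-⊆ xs⊆ys Ry ∷ AllPairs-resp-⊆ xs⊆ys Rys

sublists-⊆ : {A : Set} (xs : List A) → All (_⊆ xs) (sublists xs)
sublists-⊆ [] = [] ∷ []
sublists-⊆ (x ∷ xs) =
  AllP.++⁺ (AllP.map⁺ (All.map (refl ∷_) (sublists-⊆ xs))) (All.map (x ∷ʳ_) (sublists-⊆ xs))

allSubsets-distinct : ∀ n → Distinct (allSubsets n)
allSubsets-distinct zero = [] ∷ []
allSubsets-distinct (suc n) = AllPairsP.++⁺ (AllPairsP.map⁺ (AllPairs.map id (allSubsets-distinct n)))
  (AllPairsP.map⁺ (AllPairs.map id (allSubsets-distinct n)))
  (AllP.map⁺ (All.tabulate (λ _ → AllP.map⁺ (All.tabulate (λ _ → refl)))))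

∈-allSubsets : ∀ {n} (s : Subset n) → s ∈ allSubsets n
∈-allSubsets [] = here refl
∈-allSubsets {suc n} (true ∷ s) = AnyP.++⁺ˡ (AnyP.map⁺ (Any.map (cong (true ∷_)) (∈-allSubsets s)))
∈-allSubsets {suc n} (false ∷ s) =
  AnyP.++⁺ʳ (map (true ∷_) (allSubsets n)) (AnyP.map⁺ (Any.map (cong (false ∷_)) (∈-allSubsets s)))

kSubsets-distinct : ∀ n k → Distinct (kSubsets n k)
kSubsets-distinct n k = AllPairsP.filter⁺ _ (allSubsets-distinct n)

∈-kSubsets : ∀ n k (L : Subset n) → ∣ L ∣ ≡ k → L ∈ kSubsets n k
∈-kSubsets n k L ∣L∣≡k = ∈-filterᵇ⁺ _ (∈-allSubsets L) (dec-true (∣ L ∣ ℕ.≟ k) ∣L∣≡k)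

kSubsets-card : ∀ n k → All (λ L → ∣ L ∣ ≡ k) (kSubsets n k)
kSubsets-card n k = All.map (λ {L} → does≡true⇒ (∣ L ∣ ℕ.≟ k)) (all-filterᵇ _ (allSubsets n))

IsKGraph : ℕ → ∀ {n} → List (Subset n) → Set
IsKGraph k G = Distinct G × All (λ e → ∣ e ∣ ≡ k) G

kGraphs-are-kGraphs : ∀ n k → All (IsKGraph k) (kGraphs n k)
kGraphs-are-kGraphs n k = All.map (λ G⊆ → AllPairs-resp-⊆ G⊆ (kSubsets-distinct n k) , All-resp-⊆ G⊆ (kSubsets-card n k))
  (sublists-⊆ (kSubsets n k))

allᵇ⇒All : {A : Set} (p : A → Bool) (xs : List A) → allᵇ p xs ≡ true → All (λ x → p x ≡ true) xs
allᵇ⇒All p [] e = []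
allᵇ⇒All p (x ∷ xs) e with p x in px
... | true = px ∷ allᵇ⇒All p xs e

allᵇ-cong : {A : Set} {f g : A → Bool} (xs : List A) → (∀ x → f x ≡ g x) → allᵇ f xs ≡ allᵇ g xs
allᵇ-cong [] e = refl
allᵇ-cong (x ∷ xs) e = cong₂ _∧_ (e x) (allᵇ-cong xs e)

hasDegSeq⇒≡deg : ∀ {n} (d : DegSeq n) G a → hasDegSeq d G ≡ true → d a ≡ ℤ.+ deg G a
hasDegSeq⇒≡deg {n} d G a e = sym (does≡true⇒ (ℤ.+ deg G a ℤ.≟ d a) (All.lookup (allᵇ⇒All _ (allFin n) e) (∈-allFin a)))

hasDegSeq-cong : ∀ {n} {d d′ : DegSeq n} → (∀ a → d a ≡ d′ a) → ∀ G → hasDegSeq d G ≡ hasDegSeq d′ G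
hasDegSeq-cong {n} e G = allᵇ-cong (allFin n) (λ a → cong (λ z → does (ℤ.+ deg G a ℤ.≟ z)) (e a))

N-cong : ∀ n k {d d′ : DegSeq n} → (∀ a → d a ≡ d′ a) → N n k d ≡ N n k d′
N-cong n k e = count-cong (kGraphs n k) (hasDegSeq-cong e)

deg-∷ : ∀ {n} (e : Subset n) G a → deg (e ∷ G) a ≡ [ memᵇ a e ] ℕ.+ deg G a
deg-∷ e G a with memᵇ a e
... | true  = refl
... | false = refl

deg-insert : ∀ {n} (ys : List (Subset n)) L H a → deg (ys ++ L ∷ H) a ≡ [ memᵇ a L ] ℕ.+ deg (ys ++ H) a
deg-insert [] L H a = deg-∷ L H a
deg-insert (y ∷ ys) L H a = begin
  deg (y ∷ ys ++ L ∷ H) a                        ≡⟨ deg-∷ y (ys ++ L ∷ H) a ⟩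
  [ memᵇ a y ] ℕ.+ deg (ys ++ L ∷ H) a            ≡⟨ cong ([ memᵇ a y ] ℕ.+_) (deg-insert ys L H a) ⟩
  [ memᵇ a y ] ℕ.+ ([ memᵇ a L ] ℕ.+ deg (ys ++ H) a) ≡⟨ +-left-comm [ memᵇ a y ] [ memᵇ a L ] _ ⟩
  [ memᵇ a L ] ℕ.+ ([ memᵇ a y ] ℕ.+ deg (ys ++ H) a) ≡⟨ cong ([ memᵇ a L ] ℕ.+_) (sym (deg-∷ y (ys ++ H) a)) ⟩
  [ memᵇ a L ] ℕ.+ deg (y ∷ ys ++ H) a            ∎
  where open ≡-Reasoning

private
  degree-matches-shift : ∀ (b : Bool) (x : ℕ) (da : ℤ) →
    does (ℤ.+ ([ b ] ℕ.+ x) ℤ.≟ da) ≡ does (ℤ.+ x ℤ.≟ (da ℤ.- (if b then ℤ.+ 1 else ℤ.+ 0)))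
  degree-matches-shift true x da = does-⇔ (mk⇔ (λ e → trans (sym (1+x-1≡x (ℤ.+ x))) (cong (ℤ._- ℤ.+ 1) e))
                                                (λ e → trans (cong (λ w → ℤ.+ 1 ℤ.+ w) e) (1+[d-1]≡d da)))
      (ℤ.+ (suc x) ℤ.≟ da) (ℤ.+ x ℤ.≟ (da ℤ.- ℤ.+ 1))
    where
    open ℤSolver.+-*-Solver
    1+x-1≡x : ∀ x → (ℤ.+ 1 ℤ.+ x) ℤ.- ℤ.+ 1 ≡ x
    1+x-1≡x = solve 1 (λ x → (con (ℤ.+ 1) :+ x) :- con (ℤ.+ 1) := x) refl
    1+[d-1]≡d : ∀ d → ℤ.+ 1 ℤ.+ (d ℤ.- ℤ.+ 1) ≡ d
    1+[d-1]≡d = solve 1 (λ d → con (ℤ.+ 1) :+ (d :- con (ℤ.+ 1)) := d) refl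
  degree-matches-shift false x da = cong (does ∘ (ℤ.+ x ℤ.≟_)) (sym (ℤP.+-identityʳ da))

hasDegSeq-insert : ∀ {n} (d : DegSeq n) (ys : List (Subset n)) L H →
  hasDegSeq d (ys ++ L ∷ H) ≡ hasDegSeq (d −e L) (ys ++ H)
hasDegSeq-insert {n} d ys L H = allᵇ-cong (allFin n) (λ a →
  trans (cong (λ z → does (ℤ.+ z ℤ.≟ d a)) (deg-insert ys L H a)) (degree-matches-shift (memᵇ a L) (deg (ys ++ H) a) (d a)))

hasEdge-insert : ∀ {n} (J : Subset n) (ys : List (Subset n)) L H → eqSub J L ≡ false →
  hasEdge J (ys ++ L ∷ H) ≡ hasEdge J (ys ++ H)
hasEdge-insert J [] L H J≢L rewrite J≢L = refl
hasEdge-insert J (y ∷ ys) L H J≢L with eqSub J y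
... | true  = refl
... | false = hasEdge-insert J ys L H J≢L

hasEdge-absent : ∀ {n} (L : Subset n) (H : List (Subset n)) → All (λ y → eqSub L y ≡ false) H → hasEdge L H ≡ false
hasEdge-absent L [] [] = refl
hasEdge-absent L (y ∷ H) (L≢y ∷ L∉H) rewrite L≢y = hasEdge-absent L H L∉H

hasEdge-∷ : ∀ {n} (L : Subset n) H → hasEdge L (L ∷ H) ≡ true
hasEdge-∷ L H rewrite eqSub-refl L = refl

∈⇒split : ∀ {n} {xs : List (Subset n)} {L} → Distinct xs → L ∈ xs →
  Σ[ as ∈ List (Subset n) ] Σ[ bs ∈ List (Subset n) ]
    (xs ≡ as ++ L ∷ bs) × All (λ y → eqSub L y ≡ false) as × All (λ y → eqSub L y ≡ false) bs
∈⇒split (L≢xs ∷ _) (here refl) = [] , _ , refl , [] , L≢xs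
∈⇒split {xs = x ∷ xs} {L} (x≢xs ∷ xs-distinct) (there L∈xs) with ∈⇒split xs-distinct L∈xs
... | as , bs , refl , L∉as , L∉bs = x ∷ as , bs , refl , trans (eqSub-sym L x) (All.lookup x≢xs L∈xs) ∷ L∉as , L∉bs

count-sublists-∷ : {A : Set} (P : List A → Bool) (x : A) (xs : List A) →
  count P (sublists (x ∷ xs)) ≡ count (P ∘ (x ∷_)) (sublists xs) ℕ.+ count P (sublists xs)
count-sublists-∷ P x xs =
  trans (count-++ P (map (x ∷_) (sublists xs)) (sublists xs)) (cong (ℕ._+ _) (count-map P (x ∷_) (sublists xs)))

-- A graph of the enumeration that contains L is listed as ys ++ L ∷ H; the hypothesis says that
-- deleting L from it turns p into q.
removing-an-edge : ∀ {n} (L : Subset n) as bs → All (λ y → eqSub L y ≡ false) as → All (λ y → eqSub L y ≡ false) bs →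
  (p q : List (Subset n) → Bool) → (∀ ys H → p (ys ++ L ∷ H) ≡ q (ys ++ H)) →
  count (λ G → p G ∧ hasEdge L G) (sublists (as ++ L ∷ bs)) ≡ count (λ G → q G ∧ not (hasEdge L G)) (sublists (as ++ L ∷ bs))
removing-an-edge L [] bs [] L∉bs p q insert = begin
  count (λ G → p G ∧ hasEdge L G) (sublists (L ∷ bs))
    ≡⟨ count-sublists-∷ _ L bs ⟩
  count (λ H → p (L ∷ H) ∧ hasEdge L (L ∷ H)) S ℕ.+ count (λ G → p G ∧ hasEdge L G) S
    ≡⟨ cong₂ ℕ._+_ (count-cong S with-L) (trans (count-congᴬ S (All.map without-L L∉S)) (count-false S)) ⟩
  count q S ℕ.+ 0
    ≡⟨ ℕP.+-comm (count q S) 0 ⟩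
  0 ℕ.+ count q S
    ≡⟨ sym (cong₂ ℕ._+_ (trans (count-cong S with-L′) (count-false S)) (count-congᴬ S (All.map without-L′ L∉S))) ⟩
  count (λ H → q (L ∷ H) ∧ not (hasEdge L (L ∷ H))) S ℕ.+ count (λ G → q G ∧ not (hasEdge L G)) S
    ≡⟨ sym (count-sublists-∷ _ L bs) ⟩
  count (λ G → q G ∧ not (hasEdge L G)) (sublists (L ∷ bs)) ∎
  where
  open ≡-Reasoning
  S : List (List (Subset _))
  S = sublists bs
  L∉S : All (λ H → hasEdge L H ≡ false) S
  L∉S = All.map (λ H⊆bs → hasEdge-absent L _ (All-resp-⊆ H⊆bs L∉bs)) (sublists-⊆ bs)
  with-L : ∀ H → (p (L ∷ H) ∧ hasEdge L (L ∷ H)) ≡ q H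
  with-L H rewrite hasEdge-∷ L H | insert [] H = BP.∧-identityʳ (q H)
  with-L′ : ∀ H → (q (L ∷ H) ∧ not (hasEdge L (L ∷ H))) ≡ false
  with-L′ H rewrite hasEdge-∷ L H = BP.∧-zeroʳ (q (L ∷ H))
  without-L : ∀ {H} → hasEdge L H ≡ false → (p H ∧ hasEdge L H) ≡ false
  without-L {H} e rewrite e = BP.∧-zeroʳ (p H)
  without-L′ : ∀ {H} → hasEdge L H ≡ false → (q H ∧ not (hasEdge L H)) ≡ q H
  without-L′ {H} e rewrite e = BP.∧-identityʳ (q H)
removing-an-edge L (a ∷ as) bs (L≢a ∷ L∉as) L∉bs p q insert = begin
  count with-L (sublists (a ∷ as ++ L ∷ bs))
    ≡⟨ count-sublists-∷ with-L a (as ++ L ∷ bs) ⟩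
  count (with-L ∘ (a ∷_)) S ℕ.+ count with-L S
    ≡⟨ cong (ℕ._+ count with-L S) (count-cong S (λ H → cong (p (a ∷ H) ∧_) (skip-a H))) ⟩
  count (λ H → p (a ∷ H) ∧ hasEdge L H) S ℕ.+ count with-L S
    ≡⟨ cong₂ ℕ._+_ (removing-an-edge L as bs L∉as L∉bs (p ∘ (a ∷_)) (q ∘ (a ∷_)) (λ ys → insert (a ∷ ys)))
                   (removing-an-edge L as bs L∉as L∉bs p q insert) ⟩
  count (λ H → q (a ∷ H) ∧ not (hasEdge L H)) S ℕ.+ count without-L S
    ≡⟨ cong (ℕ._+ count without-L S) (count-cong S (λ H → cong (λ b → q (a ∷ H) ∧ not b) (sym (skip-a H)))) ⟩
  count (without-L ∘ (a ∷_)) S ℕ.+ count without-L S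
    ≡⟨ sym (count-sublists-∷ without-L a (as ++ L ∷ bs)) ⟩
  count without-L (sublists (a ∷ as ++ L ∷ bs)) ∎
  where
  open ≡-Reasoning
  S : List (List (Subset _))
  S = sublists (as ++ L ∷ bs)
  with-L without-L : List (Subset _) → Bool
  with-L G = p G ∧ hasEdge L G
  without-L G = q G ∧ not (hasEdge L G)
  skip-a : ∀ H → hasEdge L (a ∷ H) ≡ hasEdge L H
  skip-a H rewrite L≢a = refl

edge-removal : ∀ n k (L : Subset n) → ∣ L ∣ ≡ k → (d : DegSeq n) (r : List (Subset n) → Bool) →
  (∀ ys H → r (ys ++ L ∷ H) ≡ r (ys ++ H)) →
  count (λ G → (hasDegSeq d G ∧ r G) ∧ hasEdge L G) (kGraphs n k)
    ≡ count (λ G → (hasDegSeq (d −e L) G ∧ r G) ∧ not (hasEdge L G)) (kGraphs n k)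
edge-removal n k L ∣L∣≡k d r r-insert with ∈⇒split (kSubsets-distinct n k) (∈-kSubsets n k L ∣L∣≡k)
... | as , bs , kSubsets≡ , L∉as , L∉bs rewrite kSubsets≡ =
  removing-an-edge L as bs L∉as L∉bs (λ G → hasDegSeq d G ∧ r G) (λ G → hasDegSeq (d −e L) G ∧ r G)
    (λ ys H → cong₂ _∧_ (hasDegSeq-insert d ys L H) (r-insert ys H))

N-−e : ∀ n k (L : Subset n) → ∣ L ∣ ≡ k → (d : DegSeq n) → N n k (d −e L) ≡ NL n k L (d −e L) ℕ.+ NL n k L d
N-−e n k L ∣L∣≡k d = begin
  N n k (d −e L)
    ≡⟨ count-split (hasDegSeq (d −e L)) (hasEdge L) (kGraphs n k) ⟩
  NL n k L (d −e L) ℕ.+ count (λ G → hasDegSeq (d −e L) G ∧ not (hasEdge L G)) (kGraphs n k)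
    ≡⟨ cong (NL n k L (d −e L) ℕ.+_) (sym (begin
      NL n k L d
        ≡⟨ count-cong (kGraphs n k) (λ G → cong (_∧ hasEdge L G) (sym (BP.∧-identityʳ _))) ⟩
      count (λ G → (hasDegSeq d G ∧ true) ∧ hasEdge L G) (kGraphs n k)
        ≡⟨ edge-removal n k L ∣L∣≡k d (λ _ → true) (λ _ _ → refl) ⟩
      count (λ G → (hasDegSeq (d −e L) G ∧ true) ∧ not (hasEdge L G)) (kGraphs n k)
        ≡⟨ count-cong (kGraphs n k) (λ G → cong (_∧ not (hasEdge L G)) (BP.∧-identityʳ _)) ⟩
      count (λ G → hasDegSeq (d −e L) G ∧ not (hasEdge L G)) (kGraphs n k) ∎)) ⟩
  NL n k L (d −e L) ℕ.+ NL n k L d ∎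
  where open ≡-Reasoning

NL-−e : ∀ n k (J L : Subset n) → ∣ J ∣ ≡ k → eqSub L J ≡ false → (d : DegSeq n) →
  NL n k L (d −e J) ≡ NJL n k J L (d −e J) ℕ.+ NJL n k J L d
NL-−e n k J L ∣J∣≡k L≢J d = begin
  NL n k L (d −e J)
    ≡⟨ count-split (λ G → hasDegSeq (d −e J) G ∧ hasEdge L G) (hasEdge J) (kGraphs n k) ⟩
  count (λ G → (hasDegSeq (d −e J) G ∧ hasEdge L G) ∧ hasEdge J G) (kGraphs n k)
    ℕ.+ count (λ G → (hasDegSeq (d −e J) G ∧ hasEdge L G) ∧ not (hasEdge J G)) (kGraphs n k)
    ≡⟨ cong₂ ℕ._+_ (count-cong (kGraphs n k) (λ G → sym (∧-swapʳ (hasDegSeq (d −e J) G) (hasEdge J G) (hasEdge L G))))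
                   (sym (edge-removal n k J ∣J∣≡k d (hasEdge L) (λ ys H → hasEdge-insert L ys J H L≢J))) ⟩
  NJL n k J L (d −e J) ℕ.+ count (λ G → (hasDegSeq d G ∧ hasEdge L G) ∧ hasEdge J G) (kGraphs n k)
    ≡⟨ cong (NJL n k J L (d −e J) ℕ.+_) (count-cong (kGraphs n k) (λ G → sym (∧-swapʳ (hasDegSeq d G) (hasEdge J G) (hasEdge L G)))) ⟩
  NJL n k J L (d −e J) ℕ.+ NJL n k J L d ∎
  where
  open ≡-Reasoning
  ∧-swapʳ : ∀ x y z → (x ∧ y ∧ z) ≡ ((x ∧ z) ∧ y)
  ∧-swapʳ true y z = BP.∧-comm y z
  ∧-swapʳ false y z = refl

∣∪⁅⁆∣≡k : ∀ {n} k (K : Subset n) a → 1 ≤ k → ∣ K ∣ ≡ k ∸ 1 → a ∉ K → ∣ K ∪ ⁅ a ⁆ ∣ ≡ k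
∣∪⁅⁆∣≡k (suc k) K a _ ∣K∣≡k a∉K = trans (∣∪⁅⁆∣ a K a∉K) (cong suc ∣K∣≡k)

∪⁅⁆-distinct : ∀ {n} (K : Subset n) a b → a ∉ K → a ≢ b → eqSub (K ∪ ⁅ b ⁆) (K ∪ ⁅ a ⁆) ≡ false
∪⁅⁆-distinct K a b a∉K a≢b = eqSub-separated′ (K ∪ ⁅ b ⁆) (K ∪ ⁅ a ⁆) a a∉K∪b (mem-∪⁅⁆-self a K)
  where
  a∉K∪b : memᵇ a (K ∪ ⁅ b ⁆) ≡ false
  a∉K∪b rewrite mem-∪ K ⁅ b ⁆ a | ∉⇒memᵇ≡false a∉K | mem-⁅⁆-other b a (a≢b ∘ sym) = refl

Y≡frac : ∀ n k a K b (d : DegSeq n) → a ≢ b → Y n k a K b d ≡ frac (NJL n k (K ∪ ⁅ a ⁆) (K ∪ ⁅ b ⁆) d) (N n k d)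
Y≡frac n k a K b d a≢b with a FP.≟ b
... | yes a≡b = Empty.⊥-elim (a≢b a≡b)
... | no _    = refl

Y-recurrence : ∀ n k (d : DegSeq n) (K : Subset n) → 1 ≤ k → ∣ K ∣ ≡ k ∸ 1 → (a b : Fin n) → a ∉ K → a ≢ b →
  0 ℕ.< N n k (d −e (K ∪ ⁅ a ⁆)) → P n k (K ∪ ⁅ a ⁆) (d −e (K ∪ ⁅ a ⁆)) < 1ℚ →
  Y n k a K b d ≡
    (P n k (K ∪ ⁅ a ⁆) d * inv (1ℚ - P n k (K ∪ ⁅ a ⁆) (d −e (K ∪ ⁅ a ⁆))))
    * (P n k (K ∪ ⁅ b ⁆) (d −e (K ∪ ⁅ a ⁆)) - Y n k a K b (d −e (K ∪ ⁅ a ⁆)))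
Y-recurrence n k d K k≥1 ∣K∣≡k-1 a b a∉K a≢b N′>0 P′<1 = begin
  Y n k a K b d                                    ≡⟨ Y≡frac n k a K b d a≢b ⟩
  frac X N₀                                        ≡⟨ sym (frac-telescope X A N₀ A≢0) ⟩
  frac A N₀ * frac X A                             ≡⟨ cong (frac A N₀ *_) (sym (frac-telescope X N′ A N′≢0)) ⟩
  frac A N₀ * (frac N′ A * frac X N′)              ≡⟨ sym (ℚP.*-assoc (frac A N₀) (frac N′ A) (frac X N′)) ⟩
  (frac A N₀ * frac N′ A) * frac X N′              ≡⟨ cong₂ (λ u v → (frac A N₀ * u) * v) (sym (inv-frac A N′)) (sym (frac-∸ X′ X N′)) ⟩
  (frac A N₀ * inv (frac A N′)) * (frac (X′ ℕ.+ X) N′ - frac X′ N′)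
    ≡⟨ cong₂ (λ u v → (frac A N₀ * inv u) * (frac v N′ - frac X′ N′)) (sym (1-frac A′ A N′ N′≡A′+A N′≢0)) (sym NLb≡X′+X) ⟩
  (frac A N₀ * inv (1ℚ - frac A′ N′)) * (frac (NL n k Kb d′) N′ - frac X′ N′)
    ≡⟨ cong (λ y → (frac A N₀ * inv (1ℚ - frac A′ N′)) * (frac (NL n k Kb d′) N′ - y)) (sym (Y≡frac n k a K b d′ a≢b)) ⟩
  (P n k Ka d * inv (1ℚ - P n k Ka d′)) * (P n k Kb d′ - Y n k a K b d′) ∎
  where
  open ≡-Reasoning
  Ka Kb : Subset n
  Ka = K ∪ ⁅ a ⁆
  Kb = K ∪ ⁅ b ⁆
  d′ : DegSeq n
  d′ = d −e Ka
  N₀ N′ A A′ X X′ : ℕ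
  N₀ = N n k d
  N′ = N n k d′
  A  = NL n k Ka d
  A′ = NL n k Ka d′
  X  = NJL n k Ka Kb d
  X′ = NJL n k Ka Kb d′
  ∣Ka∣≡k : ∣ Ka ∣ ≡ k
  ∣Ka∣≡k = ∣∪⁅⁆∣≡k k K a k≥1 ∣K∣≡k-1 a∉K
  N′≡A′+A : N′ ≡ A′ ℕ.+ A
  N′≡A′+A = N-−e n k Ka ∣Ka∣≡k d
  NLb≡X′+X : NL n k Kb d′ ≡ X′ ℕ.+ X
  NLb≡X′+X = NL-−e n k Ka Kb ∣Ka∣≡k (∪⁅⁆-distinct K a b a∉K a≢b) d
  N′≢0 : N′ ≢ 0
  N′≢0 = ℕP.>⇒≢ N′>0
  A≢0 : A ≢ 0
  A≢0 A≡0 = ℚP.<⇒≢ P′<1 (trans (cong (frac A′) N′≡A′) (frac-self A′ (N′≢0 ∘ trans N′≡A′)))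
    where
    N′≡A′ : N′ ≡ A′
    N′≡A′ = trans N′≡A′+A (trans (cong (A′ ℕ.+_) A≡0) (ℕP.+-identityʳ A′))

[hasEdge]≡∑ : ∀ {n} (c : Subset n) (G : List (Subset n)) → Distinct G → [ hasEdge c G ] ≡ ∑ (λ e → [ eqSub c e ]) G
[hasEdge]≡∑ c [] [] = refl
[hasEdge]≡∑ c (e ∷ G) (e≢G ∷ G-distinct) with eqSub c e in c≡e
... | true rewrite eqSub⇒≡ c e c≡e = cong suc (sym (∑-zeroᴬ G (All.map (cong [_]) e≢G)))
... | false = [hasEdge]≡∑ c G G-distinct

∑-allSubsets-eqSub : ∀ n (c : Subset n) → ∑ (λ B → [ eqSub B c ]) (allSubsets n) ≡ 1
∑-allSubsets-eqSub n c with ∈⇒split (allSubsets-distinct n) (∈-allSubsets c)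
... | as , bs , allSubsets≡ , c∉as , c∉bs rewrite allSubsets≡ = begin
  ∑ (λ B → [ eqSub B c ]) (as ++ c ∷ bs)                        ≡⟨ ∑-++ _ as (c ∷ bs) ⟩
  ∑ (λ B → [ eqSub B c ]) as ℕ.+ ([ eqSub c c ] ℕ.+ ∑ (λ B → [ eqSub B c ]) bs)
    ≡⟨ cong₂ (λ x y → x ℕ.+ (y ℕ.+ ∑ (λ B → [ eqSub B c ]) bs)) (∑-zeroᴬ as (All.map absent c∉as)) (cong [_] (eqSub-refl c)) ⟩
  1 ℕ.+ ∑ (λ B → [ eqSub B c ]) bs                               ≡⟨ cong suc (∑-zeroᴬ bs (All.map absent c∉bs)) ⟩
  1                                                              ∎
  where
  open ≡-Reasoning
  absent : ∀ {y} → eqSub c y ≡ false → [ eqSub y c ] ≡ 0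
  absent {y} c≢y = cong [_] (trans (eqSub-sym y c) c≢y)

module _ {n : ℕ} (φ : Subset n → Bool) (f g : Subset n → Subset n) (g∘f≡id : ∀ B → φ B ≡ true → g (f B) ≡ B) where

  private
    preimage-indicator : ∀ B e →
      (if φ B then [ eqSub (f B) e ] else 0) ≡ [ eqSub B (g e) ] ℕ.* [ φ (g e) ∧ eqSub (f (g e)) e ]
    preimage-indicator B e with eqSub B (g e) in B≡ge
    ... | true rewrite sym (eqSub⇒≡ B (g e) B≡ge) with φ B
    ...   | true  = sym (ℕP.+-identityʳ _)
    ...   | false = refl
    preimage-indicator B e | false with φ B in φB
    ... | false = refl
    ... | true with eqSub (f B) e in fB≡e
    ...   | false = refl
    ...   | true = Empty.⊥-elim (true≢false (trans (sym (eqSub-refl B)) (trans (cong (eqSub B) B≡ge′) B≡ge)))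
      where
      B≡ge′ : B ≡ g e
      B≡ge′ = trans (sym (g∘f≡id B φB)) (cong g (eqSub⇒≡ (f B) e fB≡e))

  -- Since g inverts f on φ, an edge e is f B for at most one admissible B, namely g e.
  count-edges-in-image : ∀ (G : List (Subset n)) → Distinct G →
    ∑ (λ B → [ hasEdge (f B) G ]) (filterᵇ φ (allSubsets n)) ≡ ∑ (λ e → [ φ (g e) ∧ eqSub (f (g e)) e ]) G
  count-edges-in-image G G-distinct = begin
    ∑ (λ B → [ hasEdge (f B) G ]) (filterᵇ φ (allSubsets n))
      ≡⟨ ∑-cong (filterᵇ φ (allSubsets n)) (λ B → [hasEdge]≡∑ (f B) G G-distinct) ⟩
    ∑ (λ B → ∑ (λ e → [ eqSub (f B) e ]) G) (filterᵇ φ (allSubsets n))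
      ≡⟨ ∑-swap (λ e B → [ eqSub (f B) e ]) G (filterᵇ φ (allSubsets n)) ⟩
    ∑ (λ e → ∑ (λ B → [ eqSub (f B) e ]) (filterᵇ φ (allSubsets n))) G
      ≡⟨ ∑-cong G (λ e → trans (∑-filter _ φ (allSubsets n)) (one-preimage e)) ⟩
    ∑ (λ e → [ φ (g e) ∧ eqSub (f (g e)) e ]) G ∎
    where
    open ≡-Reasoning
    one-preimage : ∀ e → ∑ (λ B → if φ B then [ eqSub (f B) e ] else 0) (allSubsets n) ≡ [ φ (g e) ∧ eqSub (f (g e)) e ]
    one-preimage e = begin
      ∑ (λ B → if φ B then [ eqSub (f B) e ] else 0) (allSubsets n)
        ≡⟨ ∑-cong (allSubsets n) (λ B → trans (preimage-indicator B e) (ℕP.*-comm _ c)) ⟩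
      ∑ (λ B → c ℕ.* [ eqSub B (g e) ]) (allSubsets n)              ≡⟨ ∑-*ˡ c _ (allSubsets n) ⟩
      c ℕ.* ∑ (λ B → [ eqSub B (g e) ]) (allSubsets n)              ≡⟨ cong (c ℕ.*_) (∑-allSubsets-eqSub n (g e)) ⟩
      c ℕ.* 1                                                       ≡⟨ ℕP.*-identityʳ c ⟩
      c                                                             ∎
      where
      c : ℕ
      c = [ φ (g e) ∧ eqSub (f (g e)) e ]

∑-NL-swap : ∀ n k {B : Set} (F : B → Subset n) (Bs : List B) (d : DegSeq n) →
  ∑ (λ b → NL n k (F b) d) Bs ≡ ∑ (λ G → [ hasDegSeq d G ] ℕ.* ∑ (λ b → [ hasEdge (F b) G ]) Bs) (kGraphs n k)
∑-NL-swap n k F Bs d = begin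
  ∑ (λ b → NL n k (F b) d) Bs
    ≡⟨ ∑-cong Bs (λ b → trans (count≡∑ _ Gs) (∑-cong Gs (λ G → [∧] (hasDegSeq d G) (hasEdge (F b) G)))) ⟩
  ∑ (λ b → ∑ (λ G → [ hasDegSeq d G ] ℕ.* [ hasEdge (F b) G ]) Gs) Bs
    ≡⟨ ∑-swap (λ G b → [ hasDegSeq d G ] ℕ.* [ hasEdge (F b) G ]) Gs Bs ⟩
  ∑ (λ G → ∑ (λ b → [ hasDegSeq d G ] ℕ.* [ hasEdge (F b) G ]) Bs) Gs
    ≡⟨ ∑-cong Gs (λ G → ∑-*ˡ [ hasDegSeq d G ] _ Bs) ⟩
  ∑ (λ G → [ hasDegSeq d G ] ℕ.* ∑ (λ b → [ hasEdge (F b) G ]) Bs) Gs ∎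
  where
  open ≡-Reasoning
  Gs : List (List (Subset n))
  Gs = kGraphs n k

handshake : ∀ n k (d : DegSeq n) (v : Fin n) (m : ℕ) → d v ≡ ℤ.+ m → (T : List (Subset n) → ℕ) →
  (∀ G → IsKGraph k G → T G ≡ deg G v) →
  ∑ (λ G → [ hasDegSeq d G ] ℕ.* T G) (kGraphs n k) ≡ m ℕ.* N n k d
handshake n k d v m dv≡m T T≡deg = begin
  ∑ (λ G → [ hasDegSeq d G ] ℕ.* T G) (kGraphs n k)
    ≡⟨ ∑-congᴬ (kGraphs n k) (All.map (λ {G} → summand G) (kGraphs-are-kGraphs n k)) ⟩
  ∑ (λ G → m ℕ.* [ hasDegSeq d G ]) (kGraphs n k)
    ≡⟨ ∑-*ˡ m _ (kGraphs n k) ⟩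
  m ℕ.* ∑ (λ G → [ hasDegSeq d G ]) (kGraphs n k)
    ≡⟨ cong (m ℕ.*_) (sym (count≡∑ (hasDegSeq d) (kGraphs n k))) ⟩
  m ℕ.* N n k d ∎
  where
  open ≡-Reasoning
  summand : ∀ G → IsKGraph k G → [ hasDegSeq d G ] ℕ.* T G ≡ m ℕ.* [ hasDegSeq d G ]
  summand G G-kGraph with hasDegSeq d G in G⊢d
  ... | false = sym (ℕP.*-zeroʳ m)
  ... | true  = begin
    T G ℕ.+ 0  ≡⟨ ℕP.+-identityʳ (T G) ⟩
    T G        ≡⟨ T≡deg G G-kGraph ⟩
    deg G v    ≡⟨ ℤP.+-injective (trans (sym (hasDegSeq⇒≡deg d G v G⊢d)) dv≡m) ⟩
    m          ≡⟨ sym (ℕP.*-identityʳ m) ⟩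
    m ℕ.* 1    ∎

edges-through : ∀ {n} k (v : Fin n) G → IsKGraph k G →
  ∑ (λ B → [ hasEdge (B ∪ ⁅ v ⁆) G ]) (kSubsetsAvoiding n (k ∸ 1) v) ≡ deg G v
edges-through {n} k v G (G-distinct , G-card) = begin
  ∑ (λ B → [ hasEdge (B ∪ ⁅ v ⁆) G ]) (kSubsetsAvoiding n (k ∸ 1) v)
    ≡⟨ cong (∑ (λ B → [ hasEdge (B ∪ ⁅ v ⁆) G ])) (filterᵇ-filterᵇ (λ B → not (memᵇ v B)) _ (allSubsets n)) ⟩
  ∑ (λ B → [ hasEdge (B ∪ ⁅ v ⁆) G ]) (filterᵇ avoids-v (allSubsets n))
    ≡⟨ count-edges-in-image avoids-v (_∪ ⁅ v ⁆) (remove v) remove∘add G G-distinct ⟩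
  ∑ (λ e → [ avoids-v (remove v e) ∧ eqSub (remove v e ∪ ⁅ v ⁆) e ]) G
    ≡⟨ ∑-congᴬ G (All.map (λ {e} → through-v e) G-card) ⟩
  ∑ (λ e → [ memᵇ v e ]) G
    ≡⟨ sym (count≡∑ (memᵇ v) G) ⟩
  deg G v ∎
  where
  open ≡-Reasoning
  avoids-v : Subset n → Bool
  avoids-v B = does (∣ B ∣ ℕ.≟ (k ∸ 1)) ∧ not (memᵇ v B)
  remove∘add : ∀ B → avoids-v B ≡ true → remove v (B ∪ ⁅ v ⁆) ≡ B
  remove∘add B avoids = remove-∪⁅⁆ v B (memᵇ≡false⇒∉ (not≡true⇒ (proj₂ (∧≡true⇒ avoids))))
  through-v : ∀ e → ∣ e ∣ ≡ k → [ avoids-v (remove v e) ∧ eqSub (remove v e ∪ ⁅ v ⁆) e ] ≡ [ memᵇ v e ]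
  through-v e ∣e∣≡k with memᵇ v e in v∈e
  ... | true rewrite dec-true (∣ remove v e ∣ ℕ.≟ (k ∸ 1)) (cong (_∸ 1) (trans (sym (∣remove∣-∈ v e v∈e)) ∣e∣≡k))
                   | mem-remove-self v e | eqSub-ext (remove v e ∪ ⁅ v ⁆) e (λ i → cong (memᵇ i) (∪⁅⁆-remove v e v∈e)) = refl
  ... | false rewrite eqSub-separated (remove v e ∪ ⁅ v ⁆) e v (mem-∪⁅⁆-self v (remove v e)) v∈e = cong [_] (BP.∧-zeroʳ _)

∑-NL-through : ∀ n k (d : DegSeq n) (v : Fin n) (m : ℕ) → d v ≡ ℤ.+ m →
  ∑ (λ B → NL n k (B ∪ ⁅ v ⁆) d) (kSubsetsAvoiding n (k ∸ 1) v) ≡ m ℕ.* N n k d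
∑-NL-through n k d v m dv≡m = trans (∑-NL-swap n k (_∪ ⁅ v ⁆) (kSubsetsAvoiding n (k ∸ 1) v) d)
  (handshake n k d v m dv≡m _ (λ G G-kGraph → edges-through k v G G-kGraph))

module _ {n : ℕ} (k : ℕ) (i j : Fin n) (i≢j : i ≢ j) (avoids : Subset n → Bool)
         (avoids≡ : ∀ K → avoids K ≡ (not (memᵇ i K) ∧ not (memᵇ j K))) where

  private
    add-ij add-i strip : Subset n → Subset n
    add-ij K = K ∪ (⁅ i ⁆ ∪ ⁅ j ⁆)
    add-i  K = K ∪ ⁅ i ⁆
    strip  e = remove i (remove j e)

    avoids-size : ℕ → Subset n → Bool
    avoids-size m K = does (∣ K ∣ ℕ.≟ m) ∧ avoids K

    is-i : Fin n → Bool
    is-i x = does (i FP.≟ x)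
    is-j : Fin n → Bool
    is-j x = does (j FP.≟ x)

    mem-add-ij : ∀ K x → memᵇ x (add-ij K) ≡ (memᵇ x K ∨ (is-i x ∨ is-j x))
    mem-add-ij K x rewrite mem-∪ K (⁅ i ⁆ ∪ ⁅ j ⁆) x | mem-∪ ⁅ i ⁆ ⁅ j ⁆ x | mem-⁅⁆ i x | mem-⁅⁆ j x = refl

    mem-strip : ∀ e x → memᵇ x (strip e) ≡ (not (is-i x) ∧ (not (is-j x) ∧ memᵇ x e))
    mem-strip e x rewrite mem-remove i x (remove j e) | mem-remove j x e = refl

    avoids⇒ : ∀ K → avoids K ≡ true → memᵇ i K ≡ false × memᵇ j K ≡ false
    avoids⇒ K avoids-K with ∧≡true⇒ (trans (sym (avoids≡ K)) avoids-K)
    ... | i∉K , j∉K = not≡true⇒ i∉K , not≡true⇒ j∉K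

    strip∘add-ij : ∀ K → avoids-size (k ∸ 2) K ≡ true → strip (add-ij K) ≡ K
    strip∘add-ij K ok = subset-ext pointwise
      where
      pointwise : ∀ x → memᵇ x (strip (add-ij K)) ≡ memᵇ x K
      pointwise x rewrite mem-strip (add-ij K) x | mem-add-ij K x with i FP.≟ x | j FP.≟ x
      ... | yes refl | _        = sym (proj₁ (avoids⇒ K (proj₂ (∧≡true⇒ ok))))
      ... | no _     | yes refl = sym (proj₂ (avoids⇒ K (proj₂ (∧≡true⇒ ok))))
      ... | no _     | no _     = BP.∨-identityʳ _

    strip∘add-i : ∀ K → avoids-size (k ∸ 1) K ≡ true → strip (add-i K) ≡ K
    strip∘add-i K ok = subset-ext pointwise
      where
      pointwise : ∀ x → memᵇ x (strip (add-i K)) ≡ memᵇ x K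
      pointwise x rewrite mem-strip (add-i K) x | mem-∪⁅⁆ i x K with i FP.≟ x | j FP.≟ x
      ... | yes refl | _        = sym (proj₁ (avoids⇒ K (proj₂ (∧≡true⇒ ok))))
      ... | no _     | yes refl = sym (proj₂ (avoids⇒ K (proj₂ (∧≡true⇒ ok))))
      ... | no _     | no _     = BP.∨-identityʳ _

    avoids-strip : ∀ e → avoids (strip e) ≡ true
    avoids-strip e rewrite avoids≡ (strip e) | mem-strip e i | mem-strip e j
                         | dec-true (i FP.≟ i) refl | dec-true (j FP.≟ j) refl | dec-false (i FP.≟ j) i≢j = refl

    i∈add-ij : ∀ K → memᵇ i (add-ij K) ≡ true
    i∈add-ij K rewrite mem-add-ij K i | dec-true (i FP.≟ i) refl = BP.∨-zeroʳ _

    j∈add-ij : ∀ K → memᵇ j (add-ij K) ≡ true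
    j∈add-ij K rewrite mem-add-ij K j | dec-true (j FP.≟ j) refl | BP.∨-zeroʳ (is-i j) = BP.∨-zeroʳ _

    j∉add-i∘strip : ∀ e → memᵇ j (add-i (strip e)) ≡ false
    j∉add-i∘strip e rewrite mem-∪⁅⁆ i j (strip e) | mem-strip e j | dec-true (j FP.≟ j) refl | dec-false (i FP.≟ j) i≢j = refl

    add-ij∘strip : ∀ e → memᵇ i e ≡ true → memᵇ j e ≡ true → ∀ x → memᵇ x (add-ij (strip e)) ≡ memᵇ x e
    add-ij∘strip e i∈e j∈e x rewrite mem-add-ij (strip e) x | mem-strip e x with i FP.≟ x | j FP.≟ x
    ... | yes refl | _        = sym i∈e
    ... | no _     | yes refl = sym j∈e
    ... | no _     | no _     = BP.∨-identityʳ _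

    add-i∘strip : ∀ e → memᵇ i e ≡ true → memᵇ j e ≡ false → ∀ x → memᵇ x (add-i (strip e)) ≡ memᵇ x e
    add-i∘strip e i∈e j∉e x rewrite mem-∪⁅⁆ i x (strip e) | mem-strip e x with i FP.≟ x | j FP.≟ x
    ... | yes refl | _        = sym i∈e
    ... | no _     | yes refl = sym j∉e
    ... | no _     | no _     = BP.∨-identityʳ _

    i∈remove-j : ∀ e → memᵇ i e ≡ true → memᵇ i (remove j e) ≡ true
    i∈remove-j e i∈e = trans (mem-remove-other j i e (i≢j ∘ sym)) i∈e

    ∣strip∣-ij : ∀ e → ∣ e ∣ ≡ k → memᵇ i e ≡ true → memᵇ j e ≡ true → ∣ strip e ∣ ≡ k ∸ 2
    ∣strip∣-ij e ∣e∣≡k i∈e j∈e = cong (_∸ 2) (sym (trans (sym ∣e∣≡k)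
      (trans (∣remove∣-∈ j e j∈e) (cong suc (∣remove∣-∈ i (remove j e) (i∈remove-j e i∈e))))))

    ∣strip∣-i : ∀ e → ∣ e ∣ ≡ k → memᵇ i e ≡ true → memᵇ j e ≡ false → ∣ strip e ∣ ≡ k ∸ 1
    ∣strip∣-i e ∣e∣≡k i∈e j∉e = cong (_∸ 1) (sym (trans (sym ∣e∣≡k)
      (trans (∣remove∣-∉ j e j∉e) (∣remove∣-∈ i (remove j e) (i∈remove-j e i∈e)))))

    edge-through-i : ∀ e → ∣ e ∣ ≡ k →
      [ avoids-size (k ∸ 2) (strip e) ∧ eqSub (add-ij (strip e)) e ] ℕ.+ [ avoids-size (k ∸ 1) (strip e) ∧ eqSub (add-i (strip e)) e ]
        ≡ [ memᵇ i e ]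
    edge-through-i e ∣e∣≡k with memᵇ i e in i∈e | memᵇ j e in j∈e
    ... | true | true
      rewrite eqSub-ext (add-ij (strip e)) e (add-ij∘strip e i∈e j∈e)
            | eqSub-separated′ (add-i (strip e)) e j (j∉add-i∘strip e) j∈e
            | BP.∧-zeroʳ (avoids-size (k ∸ 1) (strip e)) | avoids-strip e
            | dec-true (∣ strip e ∣ ℕ.≟ (k ∸ 2)) (∣strip∣-ij e ∣e∣≡k i∈e j∈e) = refl
    ... | true | false
      rewrite eqSub-ext (add-i (strip e)) e (add-i∘strip e i∈e j∈e)
            | eqSub-separated (add-ij (strip e)) e j (j∈add-ij (strip e)) j∈e
            | BP.∧-zeroʳ (avoids-size (k ∸ 2) (strip e)) | avoids-strip e
            | dec-true (∣ strip e ∣ ℕ.≟ (k ∸ 1)) (∣strip∣-i e ∣e∣≡k i∈e j∈e) = refl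
    ... | false | _
      rewrite eqSub-separated (add-ij (strip e)) e i (i∈add-ij (strip e)) i∈e
            | eqSub-separated (add-i (strip e)) e i (mem-∪⁅⁆-self i (strip e)) i∈e
            | BP.∧-zeroʳ (avoids-size (k ∸ 2) (strip e)) | BP.∧-zeroʳ (avoids-size (k ∸ 1) (strip e)) = refl

    avoiding : ℕ → List (Subset n)
    avoiding m = filterᵇ avoids (kSubsets n m)

    edges-through-pair : ∀ G → IsKGraph k G →
      ∑ (λ K → [ hasEdge (add-ij K) G ]) (avoiding (k ∸ 2)) ℕ.+ ∑ (λ K → [ hasEdge (add-i K) G ]) (avoiding (k ∸ 1)) ≡ deg G i
    edges-through-pair G (G-distinct , G-card) = begin
      ∑ (λ K → [ hasEdge (add-ij K) G ]) (avoiding (k ∸ 2)) ℕ.+ ∑ (λ K → [ hasEdge (add-i K) G ]) (avoiding (k ∸ 1))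
        ≡⟨ cong₂ ℕ._+_ (cong (∑ (λ K → [ hasEdge (add-ij K) G ])) (filterᵇ-filterᵇ avoids _ (allSubsets n)))
                       (cong (∑ (λ K → [ hasEdge (add-i K) G ])) (filterᵇ-filterᵇ avoids _ (allSubsets n))) ⟩
      ∑ (λ K → [ hasEdge (add-ij K) G ]) (filterᵇ (avoids-size (k ∸ 2)) (allSubsets n))
        ℕ.+ ∑ (λ K → [ hasEdge (add-i K) G ]) (filterᵇ (avoids-size (k ∸ 1)) (allSubsets n))
        ≡⟨ cong₂ ℕ._+_ (count-edges-in-image (avoids-size (k ∸ 2)) add-ij strip strip∘add-ij G G-distinct)
                       (count-edges-in-image (avoids-size (k ∸ 1)) add-i strip strip∘add-i G G-distinct) ⟩
      ∑ (λ e → [ avoids-size (k ∸ 2) (strip e) ∧ eqSub (add-ij (strip e)) e ]) G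
        ℕ.+ ∑ (λ e → [ avoids-size (k ∸ 1) (strip e) ∧ eqSub (add-i (strip e)) e ]) G
        ≡⟨ sym (∑-+ _ _ G) ⟩
      ∑ (λ e → [ avoids-size (k ∸ 2) (strip e) ∧ eqSub (add-ij (strip e)) e ]
               ℕ.+ [ avoids-size (k ∸ 1) (strip e) ∧ eqSub (add-i (strip e)) e ]) G
        ≡⟨ ∑-congᴬ G (All.map (λ {e} → edge-through-i e) G-card) ⟩
      ∑ (λ e → [ memᵇ i e ]) G
        ≡⟨ sym (count≡∑ (memᵇ i) G) ⟩
      deg G i ∎
      where open ≡-Reasoning

  ∑-NL-through-pair : ∀ (d : DegSeq n) (m : ℕ) → d i ≡ ℤ.+ m →
    ∑ (λ K → NL n k (K ∪ (⁅ i ⁆ ∪ ⁅ j ⁆)) d) (filterᵇ avoids (kSubsets n (k ∸ 2)))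
      ℕ.+ ∑ (λ K → NL n k (K ∪ ⁅ i ⁆) d) (filterᵇ avoids (kSubsets n (k ∸ 1)))
    ≡ m ℕ.* N n k d
  ∑-NL-through-pair d m di≡m = begin
    ∑ (λ K → NL n k (add-ij K) d) (avoiding (k ∸ 2)) ℕ.+ ∑ (λ K → NL n k (add-i K) d) (avoiding (k ∸ 1))
      ≡⟨ cong₂ ℕ._+_ (∑-NL-swap n k add-ij (avoiding (k ∸ 2)) d) (∑-NL-swap n k add-i (avoiding (k ∸ 1)) d) ⟩
    ∑ (λ G → [ hasDegSeq d G ] ℕ.* through-ij G) (kGraphs n k) ℕ.+ ∑ (λ G → [ hasDegSeq d G ] ℕ.* through-i G) (kGraphs n k)
      ≡⟨ sym (∑-+ _ _ (kGraphs n k)) ⟩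
    ∑ (λ G → [ hasDegSeq d G ] ℕ.* through-ij G ℕ.+ [ hasDegSeq d G ] ℕ.* through-i G) (kGraphs n k)
      ≡⟨ ∑-cong (kGraphs n k) (λ G → sym (ℕP.*-distribˡ-+ [ hasDegSeq d G ] (through-ij G) (through-i G))) ⟩
    ∑ (λ G → [ hasDegSeq d G ] ℕ.* (through-ij G ℕ.+ through-i G)) (kGraphs n k)
      ≡⟨ handshake n k d i m di≡m (λ G → through-ij G ℕ.+ through-i G) edges-through-pair ⟩
    m ℕ.* N n k d ∎
    where
    open ≡-Reasoning
    through-ij through-i : List (Subset n) → ℕ
    through-ij G = ∑ (λ K → [ hasEdge (add-ij K) G ]) (avoiding (k ∸ 2))
    through-i  G = ∑ (λ K → [ hasEdge (add-i K) G ]) (avoiding (k ∸ 1))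

Disjoint : ∀ {n} → Subset n → Subset n → Set
Disjoint S T = ∀ x → memᵇ x S ≡ true → memᵇ x T ≡ false

−e-−e : ∀ {n} (d : DegSeq n) S T → Disjoint S T → ∀ x → ((d −e S) −e T) x ≡ (d −e (S ∪ T)) x
−e-−e d S T S∩T≡∅ x with memᵇ x S in x∈S | memᵇ x T in x∈T | mem-∪ S T x
... | true  | true  | _ = Empty.⊥-elim (true≢false (trans (sym x∈T) (S∩T≡∅ x x∈S)))
... | true  | false | x∈S∪T rewrite x∈S∪T = ℤP.+-identityʳ (d x ℤ.- ℤ.+ 1)
... | false | true  | x∈S∪T rewrite x∈S∪T = cong (ℤ._- ℤ.+ 1) (ℤP.+-identityʳ (d x))
... | false | false | x∈S∪T rewrite x∈S∪T = ℤP.+-identityʳ (d x ℤ.- ℤ.+ 0)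

∉⇒Disjoint-⁅⁆ : ∀ {n} (S : Subset n) a → memᵇ a S ≡ false → Disjoint S ⁅ a ⁆
∉⇒Disjoint-⁅⁆ S a a∉S x x∈S with a FP.≟ x
... | yes refl = Empty.⊥-elim (true≢false (trans (sym x∈S) a∉S))
... | no a≢x = mem-⁅⁆-other a x a≢x

∪⁅⁆-∪-fromList : ∀ {n} (pre : Subset n) y ys → (pre ∪ ⁅ y ⁆) ∪ fromList ys ≡ pre ∪ fromList (y ∷ ys)
∪⁅⁆-∪-fromList pre y ys = SubsetP.∪-assoc pre ⁅ y ⁆ (fromList ys)

∪-fromList-∪⁅⁆ : ∀ {n} (pre : Subset n) y ys → (pre ∪ fromList ys) ∪ ⁅ y ⁆ ≡ pre ∪ fromList (y ∷ ys)
∪-fromList-∪⁅⁆ pre y ys = trans (SubsetP.∪-assoc pre (fromList ys) ⁅ y ⁆) (cong (pre ∪_) (SubsetP.∪-comm (fromList ys) ⁅ y ⁆))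

-- Each factor of RBAgo shifts the degree sequence by a vertex that has not been removed yet,
-- so consecutive shifts d − e_S compose (see −e-−e).
FreshAlong : ∀ {n} → Subset n → List (Fin n) → List (Fin n) → Set
FreshAlong pre []       []       = ⊤
FreshAlong pre (a ∷ as) (b ∷ bs) =
  memᵇ a (pre ∪ fromList as) ≡ false × memᵇ b (pre ∪ fromList as) ≡ false × FreshAlong (pre ∪ ⁅ b ⁆) as bs
FreshAlong pre []       (_ ∷ _)  = Empty.⊥
FreshAlong pre (_ ∷ _)  []       = Empty.⊥

RBAgo-telescopes : ∀ n k (d : DegSeq n) (pre : Subset n) as bs → FreshAlong pre as bs →
  (∀ j → j ≤ length as → 0 ℕ.< N n k (d −e (pre ∪ fromList (take j bs ++ drop j as)))) →
  RBAgo n k d pre as bs ≡ frac (N n k (d −e (pre ∪ fromList bs))) (N n k (d −e (pre ∪ fromList as)))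
RBAgo-telescopes n k d pre [] [] _ graphical = sym (frac-self _ (ℕP.>⇒≢ (graphical 0 z≤n)))
RBAgo-telescopes n k d pre (a ∷ as) (b ∷ bs) (a-fresh , b-fresh , fresh) graphical = begin
  R n k b a (d −e S) * RBAgo n k d (pre ∪ ⁅ b ⁆) as bs
    ≡⟨ cong₂ _*_ (cong₂ frac (N-cong n k (−e-−e d S ⁅ b ⁆ (∉⇒Disjoint-⁅⁆ S b b-fresh)))
                             (N-cong n k (−e-−e d S ⁅ a ⁆ (∉⇒Disjoint-⁅⁆ S a a-fresh))))
                 (RBAgo-telescopes n k d (pre ∪ ⁅ b ⁆) as bs fresh graphical′) ⟩
  frac (N n k (d −e (S ∪ ⁅ b ⁆))) (N n k (d −e (S ∪ ⁅ a ⁆)))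
    * frac (N n k (d −e ((pre ∪ ⁅ b ⁆) ∪ fromList bs))) (N n k (d −e ((pre ∪ ⁅ b ⁆) ∪ fromList as)))
    ≡⟨ cong₂ (λ X Y → frac (N n k (d −e X)) (N n k (d −e (S ∪ ⁅ a ⁆))) * frac (N n k (d −e Y)) M)
             (trans (∪-fromList-∪⁅⁆ pre b as) (sym (∪⁅⁆-∪-fromList pre b as))) (∪⁅⁆-∪-fromList pre b bs) ⟩
  frac M (N n k (d −e (S ∪ ⁅ a ⁆))) * frac (N n k (d −e (pre ∪ fromList (b ∷ bs)))) M
    ≡⟨ frac-telescope (N n k (d −e (pre ∪ fromList (b ∷ bs)))) M (N n k (d −e (S ∪ ⁅ a ⁆))) M≢0 ⟩
  frac (N n k (d −e (pre ∪ fromList (b ∷ bs)))) (N n k (d −e (S ∪ ⁅ a ⁆)))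
    ≡⟨ cong (λ X → frac (N n k (d −e (pre ∪ fromList (b ∷ bs)))) (N n k (d −e X))) (∪-fromList-∪⁅⁆ pre a as) ⟩
  frac (N n k (d −e (pre ∪ fromList (b ∷ bs)))) (N n k (d −e (pre ∪ fromList (a ∷ as)))) ∎
  where
  open ≡-Reasoning
  S : Subset n
  S = pre ∪ fromList as
  M : ℕ
  M = N n k (d −e ((pre ∪ ⁅ b ⁆) ∪ fromList as))
  M≢0 : M ≢ 0
  M≢0 = ℕP.>⇒≢ (subst (λ X → 0 ℕ.< N n k (d −e X)) (sym (∪⁅⁆-∪-fromList pre b as)) (graphical 1 (s≤s z≤n)))
  graphical′ : ∀ j → j ≤ length as → 0 ℕ.< N n k (d −e ((pre ∪ ⁅ b ⁆) ∪ fromList (take j bs ++ drop j as)))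
  graphical′ j j≤ = subst (λ X → 0 ℕ.< N n k (d −e X)) (sym (∪⁅⁆-∪-fromList pre b (take j bs ++ drop j as))) (graphical (suc j) (s≤s j≤))

NoRepeats : ∀ {n} → List (Fin n) → Set
NoRepeats []       = ⊤
NoRepeats (x ∷ xs) = memᵇ x (fromList xs) ≡ false × NoRepeats xs

private
  filterᵇ-map : {A B : Set} (p : B → Bool) (f : A → B) (xs : List A) → filterᵇ p (map f xs) ≡ map f (filterᵇ (p ∘ f) xs)
  filterᵇ-map p f [] = refl
  filterᵇ-map p f (x ∷ xs) with p (f x)
  ... | true  = cong (f x ∷_) (filterᵇ-map p f xs)
  ... | false = filterᵇ-map p f xs

elems-∷ : ∀ {n} (x : Bool) (s : Subset n) → elems (x ∷ s) ≡ (if x then zero ∷ map suc (elems s) else map suc (elems s))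
elems-∷ {n} x s = trans (cong (filterᵇ (λ i → memᵇ i (x ∷ s))) allFin-suc) (by-cases x)
  where
  allFin-suc : allFin (suc n) ≡ zero ∷ map suc (allFin n)
  allFin-suc = cong (zero ∷_) (sym (LP.map-tabulate id suc))
  by-cases : ∀ x → filterᵇ (λ i → memᵇ i (x ∷ s)) (zero ∷ map suc (allFin n))
                   ≡ (if x then zero ∷ map suc (elems s) else map suc (elems s))
  by-cases true  = cong (zero ∷_) (filterᵇ-map (λ i → memᵇ i (true ∷ s)) suc (allFin n))
  by-cases false = filterᵇ-map (λ i → memᵇ i (false ∷ s)) suc (allFin n)

fromList-map-suc : ∀ {n} (xs : List (Fin n)) → fromList (map suc xs) ≡ false ∷ fromList xs
fromList-map-suc [] = refl
fromList-map-suc (x ∷ xs) rewrite fromList-map-suc xs = refl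

fromList-elems : ∀ {n} (s : Subset n) → fromList (elems s) ≡ s
fromList-elems [] = refl
fromList-elems (x ∷ s) rewrite elems-∷ x s with x
... | true  rewrite fromList-map-suc (elems s) | fromList-elems s | SubsetP.∪-identityˡ s = refl
... | false rewrite fromList-map-suc (elems s) | fromList-elems s = refl

length-elems : ∀ {n} (s : Subset n) → length (elems s) ≡ ∣ s ∣
length-elems [] = refl
length-elems (x ∷ s) rewrite elems-∷ x s with x
... | true  = cong suc (trans (LP.length-map suc (elems s)) (length-elems s))
... | false = trans (LP.length-map suc (elems s)) (length-elems s)

map-suc-noRepeats : ∀ {n} (xs : List (Fin n)) → NoRepeats xs → NoRepeats (map suc xs)
map-suc-noRepeats [] _ = tt
map-suc-noRepeats (x ∷ xs) (x∉xs , xs-ok) rewrite fromList-map-suc xs = x∉xs , map-suc-noRepeats xs xs-ok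

elems-noRepeats : ∀ {n} (s : Subset n) → NoRepeats (elems s)
elems-noRepeats [] = tt
elems-noRepeats (x ∷ s) rewrite elems-∷ x s with x
... | true  rewrite fromList-map-suc (elems s) = refl , map-suc-noRepeats (elems s) (elems-noRepeats s)
... | false = map-suc-noRepeats (elems s) (elems-noRepeats s)

mem-setMinus : ∀ {n} (s t : Subset n) x → memᵇ x (setMinus s t) ≡ (memᵇ x s ∧ not (memᵇ x t))
mem-setMinus (a ∷ s) (b ∷ t) zero    = refl
mem-setMinus (a ∷ s) (b ∷ t) (suc x) = mem-setMinus s t x

count-∉-elems : ∀ {n} (A B : Subset n) → count (λ x → not (memᵇ x B)) (elems A) ≡ ∣ setMinus A B ∣
count-∉-elems [] [] = refl
count-∉-elems (x ∷ A) (y ∷ B) rewrite elems-∷ x A with x | y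
... | true  | true  = trans (count-map _ suc (elems A)) (count-∉-elems A B)
... | true  | false = cong suc (trans (count-map _ suc (elems A)) (count-∉-elems A B))
... | false | _     = trans (count-map _ suc (elems A)) (count-∉-elems A B)

∣setMinus∣-sym : ∀ {n} (A B : Subset n) → ∣ A ∣ ≡ ∣ B ∣ → ∣ setMinus B A ∣ ≡ ∣ setMinus A B ∣
∣setMinus∣-sym A B ∣A∣≡∣B∣ = ℕP.+-cancelˡ-≡ ∣ A ∣ _ _ (trans (∣A∣+∣B∖A∣ A B) (cong (ℕ._+ ∣ setMinus A B ∣) (sym ∣A∣≡∣B∣)))
  where
  ∣A∣+∣B∖A∣ : ∀ {n} (A B : Subset n) → ∣ A ∣ ℕ.+ ∣ setMinus B A ∣ ≡ ∣ B ∣ ℕ.+ ∣ setMinus A B ∣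
  ∣A∣+∣B∖A∣ [] [] = refl
  ∣A∣+∣B∖A∣ (true ∷ A)  (true ∷ B)  = cong suc (∣A∣+∣B∖A∣ A B)
  ∣A∣+∣B∖A∣ (true ∷ A)  (false ∷ B) = trans (cong suc (∣A∣+∣B∖A∣ A B)) (sym (ℕP.+-suc ∣ B ∣ _))
  ∣A∣+∣B∖A∣ (false ∷ A) (true ∷ B)  = trans (ℕP.+-suc ∣ A ∣ _) (cong suc (∣A∣+∣B∖A∣ A B))
  ∣A∣+∣B∖A∣ (false ∷ A) (false ∷ B) = ∣A∣+∣B∖A∣ A B

mem-fromList-∷ : ∀ {n} (y : Fin n) ys x → memᵇ x (fromList (y ∷ ys)) ≡ (memᵇ x ⁅ y ⁆ ∨ memᵇ x (fromList ys))
mem-fromList-∷ y ys x = mem-∪ ⁅ y ⁆ (fromList ys) x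

mem-fromList-head : ∀ {n} (y : Fin n) ys → memᵇ y (fromList (y ∷ ys)) ≡ true
mem-fromList-head y ys rewrite mem-fromList-∷ y ys y | mem-⁅⁆-self y = refl

mem-fromList-tail : ∀ {n} (y : Fin n) ys x → memᵇ x (fromList (y ∷ ys)) ≡ false → memᵇ x (fromList ys) ≡ false
mem-fromList-tail y ys x x∉ = proj₂ (∨≡false⇒ (trans (sym (mem-fromList-∷ y ys x)) x∉))

Disjoint⇒∉ : ∀ {n} (S T : Subset n) → Disjoint S T → ∀ y → memᵇ y T ≡ true → memᵇ y S ≡ false
Disjoint⇒∉ S T S∩T≡∅ y y∈T with memᵇ y S in y∈S
... | true  = Empty.⊥-elim (true≢false (trans (sym y∈T) (S∩T≡∅ y y∈S)))
... | false = refl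

∉-∪ : ∀ {n} (S T : Subset n) y → memᵇ y S ≡ false → memᵇ y T ≡ false → memᵇ y (S ∪ T) ≡ false
∉-∪ S T y y∉S y∉T rewrite mem-∪ S T y | y∉S | y∉T = refl

Disjoint-∪⁅⁆ : ∀ {n} (S T : Subset n) y → Disjoint S T → memᵇ y T ≡ false → Disjoint (S ∪ ⁅ y ⁆) T
Disjoint-∪⁅⁆ S T y S∩T≡∅ y∉T x x∈S∪y rewrite mem-∪⁅⁆ y x S with memᵇ x S in x∈S | y FP.≟ x
... | true  | _        = S∩T≡∅ x x∈S
... | false | yes refl = y∉T

Disjoint-fromList-tail : ∀ {n} (S : Subset n) y ys → Disjoint S (fromList (y ∷ ys)) → Disjoint S (fromList ys)
Disjoint-fromList-tail S y ys S∩yys≡∅ x x∈S = mem-fromList-tail y ys x (S∩yys≡∅ x x∈S)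

arrange-fresh : ∀ {n} (B : Subset n) pre as q → NoRepeats as → NoRepeats q →
  Disjoint (fromList q) (fromList as) → Disjoint pre (fromList as) → Disjoint pre (fromList q) →
  length q ≡ count (λ x → not (memᵇ x B)) as → FreshAlong pre as (arrange B as q)
arrange-fresh B pre [] [] _ _ _ _ _ _ = tt
arrange-fresh B pre (a ∷ as) q (a∉as , as-ok) q-ok q∩as pre∩as pre∩q ∣q∣ with memᵇ a B in a∈B
... | true =
  a-fresh , a-fresh ,
  arrange-fresh B (pre ∪ ⁅ a ⁆) as q as-ok q-ok (Disjoint-fromList-tail (fromList q) a as q∩as)
    (Disjoint-∪⁅⁆ pre (fromList as) a (Disjoint-fromList-tail pre a as pre∩as) a∉as)
    (Disjoint-∪⁅⁆ pre (fromList q) a pre∩q (Disjoint⇒∉ (fromList q) (fromList (a ∷ as)) q∩as a (mem-fromList-head a as)))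
    ∣q∣
  where
  a-fresh : memᵇ a (pre ∪ fromList as) ≡ false
  a-fresh = ∉-∪ pre (fromList as) a (Disjoint⇒∉ pre (fromList (a ∷ as)) pre∩as a (mem-fromList-head a as)) a∉as
arrange-fresh B pre (a ∷ as) (y ∷ q) (a∉as , as-ok) (y∉q , q-ok) q∩as pre∩as pre∩q ∣q∣ | false =
  ∉-∪ pre (fromList as) a (Disjoint⇒∉ pre (fromList (a ∷ as)) pre∩as a (mem-fromList-head a as)) a∉as ,
  ∉-∪ pre (fromList as) y (Disjoint⇒∉ pre (fromList (y ∷ q)) pre∩q y (mem-fromList-head y q)) y∉as ,
  arrange-fresh B (pre ∪ ⁅ y ⁆) as q as-ok q-ok q∩as′
    (Disjoint-∪⁅⁆ pre (fromList as) y (Disjoint-fromList-tail pre a as pre∩as) y∉as)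
    (Disjoint-∪⁅⁆ pre (fromList q) y (Disjoint-fromList-tail pre y q pre∩q) y∉q)
    (ℕP.suc-injective ∣q∣)
  where
  y∉as : memᵇ y (fromList as) ≡ false
  y∉as = mem-fromList-tail a as y (q∩as y (mem-fromList-head y q))
  q∩as′ : Disjoint (fromList q) (fromList as)
  q∩as′ x x∈q = mem-fromList-tail a as x (q∩as x (trans (mem-fromList-∷ y q x) (trans (cong (memᵇ x ⁅ y ⁆ ∨_) x∈q) (BP.∨-zeroʳ _))))

mem-arrange : ∀ {n} (B : Subset n) as q → length q ≡ count (λ x → not (memᵇ x B)) as → ∀ x →
  memᵇ x (fromList (arrange B as q)) ≡ ((memᵇ x (fromList as) ∧ memᵇ x B) ∨ memᵇ x (fromList q))
mem-arrange B [] [] _ x rewrite mem-⊥ x = refl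
mem-arrange B (a ∷ as) q ∣q∣ x with memᵇ a B in a∈B
mem-arrange B (a ∷ as) q ∣q∣ x | true
  rewrite mem-fromList-∷ a (arrange B as q) x | mem-fromList-∷ a as x | mem-arrange B as q ∣q∣ x with a FP.≟ x
... | yes refl rewrite mem-⁅⁆-self a | a∈B = refl
... | no a≢x   rewrite mem-⁅⁆-other a x a≢x = refl
mem-arrange B (a ∷ as) (y ∷ q) ∣q∣ x | false
  rewrite mem-fromList-∷ y (arrange B as q) x | mem-fromList-∷ a as x | mem-fromList-∷ y q x
        | mem-arrange B as q (ℕP.suc-injective ∣q∣) x with a FP.≟ x
... | yes refl rewrite mem-⁅⁆-self a | a∈B | BP.∧-zeroʳ (memᵇ a (fromList as)) = refl
... | no a≢x   rewrite mem-⁅⁆-other a x a≢x = ∨-left-comm (memᵇ x ⁅ y ⁆) (memᵇ x (fromList as) ∧ memᵇ x B) (memᵇ x (fromList q))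
  where
  ∨-left-comm : ∀ p r s → (p ∨ (r ∨ s)) ≡ (r ∨ (p ∨ s))
  ∨-left-comm true  r s = sym (BP.∨-zeroʳ r)
  ∨-left-comm false r s = refl

RBA≡frac : ∀ n k (d : DegSeq n) (A B : Subset n) → ∣ A ∣ ≡ ∣ B ∣ →
  (∀ j → j ≤ ∣ A ∣ → 0 ℕ.< N n k (d −e mixSet A B j)) →
  RBA n k B A d ≡ frac (N n k (d −e B)) (N n k (d −e A))
RBA≡frac n k d A B ∣A∣≡∣B∣ graphical = begin
  RBAgo n k d ⊥ as bs
    ≡⟨ RBAgo-telescopes n k d ⊥ as bs fresh graphical′ ⟩
  frac (N n k (d −e (⊥ ∪ fromList bs))) (N n k (d −e (⊥ ∪ fromList as)))
    ≡⟨ cong₂ (λ X Y → frac (N n k (d −e X)) (N n k (d −e Y)))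
             (trans (SubsetP.∪-identityˡ (fromList bs)) fromList-bs≡B)
             (trans (SubsetP.∪-identityˡ (fromList as)) (fromList-elems A)) ⟩
  frac (N n k (d −e B)) (N n k (d −e A)) ∎
  where
  open ≡-Reasoning
  as q bs : List (Fin n)
  as = elems A
  q  = elems (setMinus B A)
  bs = arrange B as q
  ∣q∣ : length q ≡ count (λ x → not (memᵇ x B)) as
  ∣q∣ = trans (length-elems (setMinus B A)) (trans (∣setMinus∣-sym A B ∣A∣≡∣B∣) (sym (count-∉-elems A B)))
  q∩as : Disjoint (fromList q) (fromList as)
  q∩as x x∈q rewrite fromList-elems A
    with memᵇ x A | trans (sym (mem-setMinus B A x)) (trans (cong (memᵇ x) (sym (fromList-elems (setMinus B A)))) x∈q)
  ... | false | _ = refl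
  ... | true  | x∈B∧false rewrite BP.∧-zeroʳ (memᵇ x B) = Empty.⊥-elim (true≢false (sym x∈B∧false))
  ⊥∩ : ∀ T → Disjoint ⊥ T
  ⊥∩ T x x∈⊥ = Empty.⊥-elim (true≢false (trans (sym x∈⊥) (mem-⊥ x)))
  fresh : FreshAlong ⊥ as bs
  fresh = arrange-fresh B ⊥ as q (elems-noRepeats A) (elems-noRepeats (setMinus B A)) q∩as (⊥∩ (fromList as)) (⊥∩ (fromList q)) ∣q∣
  graphical′ : ∀ j → j ≤ length as → 0 ℕ.< N n k (d −e (⊥ ∪ fromList (take j bs ++ drop j as)))
  graphical′ j j≤ rewrite SubsetP.∪-identityˡ (fromList (take j bs ++ drop j as)) =
    graphical j (subst (j ≤_) (length-elems A) j≤)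
  fromList-bs≡B : fromList bs ≡ B
  fromList-bs≡B = subset-ext pointwise
    where
    pointwise : ∀ x → memᵇ x (fromList bs) ≡ memᵇ x B
    pointwise x rewrite mem-arrange B as q ∣q∣ x | fromList-elems A | fromList-elems (setMinus B A) | mem-setMinus B A x
      with memᵇ x A | memᵇ x B
    ... | true  | true  = refl
    ... | true  | false = refl
    ... | false | true  = refl
    ... | false | false = refl

kSubsetsAvoiding-members : ∀ n m v → All (λ B → ∣ B ∣ ≡ m × v ∉ B) (kSubsetsAvoiding n m v)
kSubsetsAvoiding-members n m v = All.zip (AllP.filter⁺ _ (kSubsets-card n m) ,
  All.map (memᵇ≡false⇒∉ ∘ not≡true⇒) (all-filterᵇ (λ B → not (memᵇ v B)) (kSubsets n m)))

∈-kSubsetsAvoiding : ∀ n m v (A : Subset n) → ∣ A ∣ ≡ m → v ∉ A → A ∈ kSubsetsAvoiding n m v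
∈-kSubsetsAvoiding n m v A ∣A∣≡m v∉A = ∈-filterᵇ⁺ _ (∈-kSubsets n m A ∣A∣≡m) (cong not (∉⇒memᵇ≡false v∉A))

−e⁅⁆-−e : ∀ {n} (d : DegSeq n) v B → v ∉ B → ∀ x → ((d −e ⁅ v ⁆) −e B) x ≡ (d −e (B ∪ ⁅ v ⁆)) x
−e⁅⁆-−e d v B v∉B x = trans (−e-−e d ⁅ v ⁆ B v∩B x) (cong (λ S → (d −e S) x) (SubsetP.∪-comm ⁅ v ⁆ B))
  where
  v∩B : Disjoint ⁅ v ⁆ B
  v∩B y y∈v with v FP.≟ y
  ... | yes refl = ∉⇒memᵇ≡false v∉B
  ... | no v≢y   = Empty.⊥-elim (true≢false (trans (sym y∈v) (mem-⁅⁆-other v y v≢y)))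

RBA-summand : ∀ n k → 1 ≤ k → (d : DegSeq n) (A B : Subset n) (v : Fin n) →
  ∣ A ∣ ≡ k ∸ 1 → v ∉ A → ∣ B ∣ ≡ k ∸ 1 → v ∉ B → NL n k (A ∪ ⁅ v ⁆) d ≢ 0 →
  (∀ j → j ≤ k ∸ 1 → 0 ℕ.< N n k ((d −e ⁅ v ⁆) −e mixSet A B j)) →
  RBA n k B A (d −e ⁅ v ⁆) * ((1ℚ - P n k (B ∪ ⁅ v ⁆) (d −e (B ∪ ⁅ v ⁆))) * inv (1ℚ - P n k (A ∪ ⁅ v ⁆) (d −e (A ∪ ⁅ v ⁆))))
    ≡ frac (NL n k (B ∪ ⁅ v ⁆) d) (NL n k (A ∪ ⁅ v ⁆) d)
RBA-summand n k k≥1 d A B v ∣A∣≡k-1 v∉A ∣B∣≡k-1 v∉B NLA≢0 graphical = begin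
  RBA n k B A (d −e ⁅ v ⁆) * ((1ℚ - frac b′ NB) * inv (1ℚ - frac a′ NA))
    ≡⟨ cong₂ (λ r u → r * ((1ℚ - frac b′ NB) * inv u)) RBA≡NB/NA (1-frac a′ NLA NA NA≡a′+NLA NA≢0) ⟩
  frac NB NA * ((1ℚ - frac b′ NB) * inv (frac NLA NA))
    ≡⟨ sym (ℚP.*-assoc (frac NB NA) (1ℚ - frac b′ NB) (inv (frac NLA NA))) ⟩
  (frac NB NA * (1ℚ - frac b′ NB)) * inv (frac NLA NA)
    ≡⟨ cong₂ (λ N′ u → (frac N′ NA * (1ℚ - frac b′ N′)) * u) NB≡b′+NLB (inv-frac NLA NA) ⟩
  (frac (b′ ℕ.+ NLB) NA * (1ℚ - frac b′ (b′ ℕ.+ NLB))) * frac NA NLA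
    ≡⟨ cong (_* frac NA NLA) (frac-*-1-frac b′ NLB NA) ⟩
  frac NLB NA * frac NA NLA
    ≡⟨ ℚP.*-comm (frac NLB NA) (frac NA NLA) ⟩
  frac NA NLA * frac NLB NA
    ≡⟨ frac-telescope NLB NA NLA NA≢0 ⟩
  frac NLB NLA ∎
  where
  open ≡-Reasoning
  Av Bv : Subset n
  Av = A ∪ ⁅ v ⁆
  Bv = B ∪ ⁅ v ⁆
  NA NB NLA NLB a′ b′ : ℕ
  NA  = N n k (d −e Av)
  NB  = N n k (d −e Bv)
  NLA = NL n k Av d
  NLB = NL n k Bv d
  a′  = NL n k Av (d −e Av)
  b′  = NL n k Bv (d −e Bv)
  NA≡a′+NLA : NA ≡ a′ ℕ.+ NLA
  NA≡a′+NLA = N-−e n k Av (∣∪⁅⁆∣≡k k A v k≥1 ∣A∣≡k-1 v∉A) d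
  NB≡b′+NLB : NB ≡ b′ ℕ.+ NLB
  NB≡b′+NLB = N-−e n k Bv (∣∪⁅⁆∣≡k k B v k≥1 ∣B∣≡k-1 v∉B) d
  NA≢0 : NA ≢ 0
  NA≢0 NA≡0 = NLA≢0 (ℕP.m+n≡0⇒n≡0 a′ (trans (sym NA≡a′+NLA) NA≡0))
  RBA≡NB/NA : RBA n k B A (d −e ⁅ v ⁆) ≡ frac NB NA
  RBA≡NB/NA = trans (RBA≡frac n k (d −e ⁅ v ⁆) A B (trans ∣A∣≡k-1 (sym ∣B∣≡k-1))
                       (λ j j≤ → graphical j (subst (j ≤_) ∣A∣≡k-1 j≤)))
                    (cong₂ frac (N-cong n k (−e⁅⁆-−e d v B v∉B)) (N-cong n k (−e⁅⁆-−e d v A v∉A)))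

P-via-RBA : ∀ n k → 1 ≤ k → (d : DegSeq n) (A : Subset n) → ∣ A ∣ ≡ k ∸ 1 → (v : Fin n) → v ∉ A →
  0ℚ < P n k (A ∪ ⁅ v ⁆) d →
  ((B : Subset n) → ∣ B ∣ ≡ k ∸ 1 → v ∉ B → (j : ℕ) → j ≤ k ∸ 1 → 0 ℕ.< N n k ((d −e ⁅ v ⁆) −e mixSet A B j)) →
  P n k (A ∪ ⁅ v ⁆) d ≡
    toℚ (d v) * inv (sumℚ (map (λ B →
        RBA n k B A (d −e ⁅ v ⁆)
        * ((1ℚ - P n k (B ∪ ⁅ v ⁆) (d −e (B ∪ ⁅ v ⁆))) * inv (1ℚ - P n k (A ∪ ⁅ v ⁆) (d −e (A ∪ ⁅ v ⁆)))))
      (kSubsetsAvoiding n (k ∸ 1) v)))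
P-via-RBA n k k≥1 d A ∣A∣≡k-1 v v∉A P>0 graphical
  with count-positive (hasDegSeq d) (kGraphs n k) (ℕP.n≢0⇒n>0 (frac≢0⇒denominator≢0 NLA (N n k d) P≢0))
  where
  NLA : ℕ
  NLA = NL n k (A ∪ ⁅ v ⁆) d
  P≢0 : P n k (A ∪ ⁅ v ⁆) d ≢ 0ℚ
  P≢0 = ℚP.<⇒≢ P>0 ∘ sym
... | G , G⊢d = sym (begin
  toℚ (d v) * inv (sumℚ (map summand L))
    ≡⟨ cong₂ (λ x y → x * inv (sumℚ y)) (cong toℚ dv≡m)
             (LP.map-cong-local (All.map (λ (∣B∣≡k-1 , v∉B) → RBA-summand n k k≥1 d A _ v ∣A∣≡k-1 v∉A ∣B∣≡k-1 v∉B NLA≢0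
                                            (graphical _ ∣B∣≡k-1 v∉B))
                                         (kSubsetsAvoiding-members n (k ∸ 1) v))) ⟩
  fromℕ m * inv (sumℚ (map (λ B → frac (NL n k (B ∪ ⁅ v ⁆) d) NLA) L))
    ≡⟨ cong (λ x → fromℕ m * inv x) (sumℚ-frac (λ B → NL n k (B ∪ ⁅ v ⁆) d) NLA L) ⟩
  fromℕ m * inv (frac (∑ (λ B → NL n k (B ∪ ⁅ v ⁆) d) L) NLA)
    ≡⟨ cong (λ x → fromℕ m * inv (frac x NLA)) handshake-v ⟩
  fromℕ m * inv (frac (m ℕ.* N n k d) NLA)
    ≡⟨ cong (fromℕ m *_) (inv-frac (m ℕ.* N n k d) NLA) ⟩
  fromℕ m * frac NLA (m ℕ.* N n k d)
    ≡⟨ fromℕ-*-frac m NLA (N n k d) m≢0 ⟩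
  frac NLA (N n k d) ∎)
  where
  open ≡-Reasoning
  L : List (Subset n)
  L = kSubsetsAvoiding n (k ∸ 1) v
  summand : Subset n → ℚ
  summand B = RBA n k B A (d −e ⁅ v ⁆)
    * ((1ℚ - P n k (B ∪ ⁅ v ⁆) (d −e (B ∪ ⁅ v ⁆))) * inv (1ℚ - P n k (A ∪ ⁅ v ⁆) (d −e (A ∪ ⁅ v ⁆))))
  NLA m : ℕ
  NLA = NL n k (A ∪ ⁅ v ⁆) d
  m = deg G v
  dv≡m : d v ≡ ℤ.+ m
  dv≡m = hasDegSeq⇒≡deg d G v G⊢d
  NLA≢0 : NLA ≢ 0
  NLA≢0 = frac≢0⇒numerator≢0 NLA (N n k d) (ℚP.<⇒≢ P>0 ∘ sym)
  handshake-v : ∑ (λ B → NL n k (B ∪ ⁅ v ⁆) d) L ≡ m ℕ.* N n k d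
  handshake-v = ∑-NL-through n k d v m dv≡m
  m≢0 : m ≢ 0
  m≢0 m≡0 = NLA≢0 (ℕP.n≤0⇒n≡0 (subst (NLA ≤_) (trans handshake-v (cong (ℕ._* N n k d) m≡0))
    (∑-≥ (λ B → NL n k (B ∪ ⁅ v ⁆) d) L (∈-kSubsetsAvoiding n (k ∸ 1) v A ∣A∣≡k-1 v∉A))))

ratio-from-double-counting : ∀ ma mb Na Nb Xa Xb S → ma ≢ 0 → mb ≢ 0 → Na ≢ 0 → Nb ≢ 0 →
  ma ℕ.* Nb ≡ Xb ℕ.+ S → mb ℕ.* Na ≡ Xa ℕ.+ S → inv (fromℕ mb) * frac Xa Na < 1ℚ →
  frac Na Nb ≡ (fromℕ ma * inv (fromℕ mb)) * ((1ℚ - inv (fromℕ ma) * frac Xb Nb) * inv (1ℚ - inv (fromℕ mb) * frac Xa Na))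
ratio-from-double-counting ma mb Na Nb Xa Xb S ma≢0 mb≢0 Na≢0 Nb≢0 maNb≡Xb+S mbNa≡Xa+S Ba<1 = sym (begin
  ma/mb * ((1ℚ - inv (fromℕ ma) * frac Xb Nb) * inv (1ℚ - inv (fromℕ mb) * frac Xa Na))
    ≡⟨ cong₂ (λ x y → ma/mb * ((1ℚ - x) * inv (1ℚ - y))) (inv-fromℕ-*-frac ma Xb Nb) (inv-fromℕ-*-frac mb Xa Na) ⟩
  ma/mb * ((1ℚ - frac Xb (ma ℕ.* Nb)) * inv (1ℚ - frac Xa (mb ℕ.* Na)))
    ≡⟨ cong₂ (λ x y → ma/mb * (x * inv y)) (1-frac Xb S _ maNb≡Xb+S maNb≢0) (1-frac Xa S _ mbNa≡Xa+S mbNa≢0) ⟩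
  ma/mb * (frac S (ma ℕ.* Nb) * inv (frac S (mb ℕ.* Na)))
    ≡⟨ cong (λ x → ma/mb * (frac S (ma ℕ.* Nb) * x)) (inv-frac S (mb ℕ.* Na)) ⟩
  ma/mb * (frac S (ma ℕ.* Nb) * frac (mb ℕ.* Na) S)
    ≡⟨ cong (ma/mb *_) (frac-telescope (mb ℕ.* Na) S (ma ℕ.* Nb) S≢0) ⟩
  ma/mb * frac (mb ℕ.* Na) (ma ℕ.* Nb)
    ≡⟨ frac-rescale ma mb Na Nb ma≢0 mb≢0 ⟩
  frac Na Nb ∎)
  where
  open ≡-Reasoning
  ma/mb : ℚ
  ma/mb = fromℕ ma * inv (fromℕ mb)
  *≢0 : ∀ {x y} → x ≢ 0 → y ≢ 0 → x ℕ.* y ≢ 0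
  *≢0 {x} x≢0 y≢0 xy≡0 with ℕP.m*n≡0⇒m≡0∨n≡0 x xy≡0
  ... | inj₁ x≡0 = x≢0 x≡0
  ... | inj₂ y≡0 = y≢0 y≡0
  maNb≢0 : ma ℕ.* Nb ≢ 0
  maNb≢0 = *≢0 ma≢0 Nb≢0
  mbNa≢0 : mb ℕ.* Na ≢ 0
  mbNa≢0 = *≢0 mb≢0 Na≢0
  S≢0 : S ≢ 0
  S≢0 S≡0 = ℚP.<⇒≢ Ba<1 (begin
    inv (fromℕ mb) * frac Xa Na   ≡⟨ inv-fromℕ-*-frac mb Xa Na ⟩
    frac Xa (mb ℕ.* Na)          ≡⟨ cong (frac Xa) mbNa≡Xa ⟩
    frac Xa Xa                   ≡⟨ frac-self Xa (mbNa≢0 ∘ trans mbNa≡Xa) ⟩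
    1ℚ                           ∎)
    where
    mbNa≡Xa : mb ℕ.* Na ≡ Xa
    mbNa≡Xa = trans mbNa≡Xa+S (trans (cong (Xa ℕ.+_) S≡0) (ℕP.+-identityʳ Xa))

graphical-−e⁅⁆⇒degree-positive : ∀ n k (d : DegSeq n) a → 0 ℕ.< N n k (d −e ⁅ a ⁆) → Σ[ t ∈ ℕ ] d a ≡ ℤ.+ suc t
graphical-−e⁅⁆⇒degree-positive n k d a N>0 with count-positive (hasDegSeq (d −e ⁅ a ⁆)) (kGraphs n k) N>0
... | G , G⊢d-a = deg G a , (begin
  d a                          ≡⟨ sym (1+[d-1]≡d (d a)) ⟩
  ℤ.+ 1 ℤ.+ (d a ℤ.- ℤ.+ 1)    ≡⟨ cong (λ b → ℤ.+ 1 ℤ.+ (d a ℤ.- (if b then ℤ.+ 1 else ℤ.+ 0))) (sym (mem-⁅⁆-self a)) ⟩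
  ℤ.+ 1 ℤ.+ (d −e ⁅ a ⁆) a     ≡⟨ cong (λ w → ℤ.+ 1 ℤ.+ w) (hasDegSeq⇒≡deg (d −e ⁅ a ⁆) G a G⊢d-a) ⟩
  ℤ.+ suc (deg G a)            ∎)
  where
  open ≡-Reasoning
  open ℤSolver.+-*-Solver
  1+[d-1]≡d : ∀ d → ℤ.+ 1 ℤ.+ (d ℤ.- ℤ.+ 1) ≡ d
  1+[d-1]≡d = solve 1 (λ d → con (ℤ.+ 1) :+ (d :- con (ℤ.+ 1)) := d) refl

module _ (n k : ℕ) (k≥1 : 1 ≤ k) (d : DegSeq n) (a b : Fin n) (a≢b : a ≢ b) where

  private
    avoids-ab : Subset n → Bool
    avoids-ab K = not (memᵇ a K) ∧ not (memᵇ b K)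

    avoiding : ℕ → List (Subset n)
    avoiding m = filterᵇ avoids-ab (kSubsets n m)

    NL-without : DegSeq n → Subset n → Subset n → ℕ
    NL-without d′ Ki Kj = count (λ G → (hasDegSeq d′ G ∧ hasEdge Ki G) ∧ not (hasEdge Kj G)) (kGraphs n k)

    B-numerator : Fin n → Fin n → DegSeq n → ℕ
    B-numerator i j d′ = ∑ (λ K → NL n k (K ∪ (⁅ i ⁆ ∪ ⁅ j ⁆)) d′) (avoiding (k ∸ 2))
                         ℕ.+ ∑ (λ K → NJL n k (K ∪ ⁅ i ⁆) (K ∪ ⁅ j ⁆) d′) (avoiding (k ∸ 1))

    B-slack : Fin n → Fin n → DegSeq n → ℕ
    B-slack i j d′ = ∑ (λ K → NL-without d′ (K ∪ ⁅ i ⁆) (K ∪ ⁅ j ⁆)) (avoiding (k ∸ 1))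

    Bfun≡frac : ∀ i j → i ≢ j → (d′ : DegSeq n) →
      Bfun n k d a b i j d′ ≡ inv (toℚ (d i)) * frac (B-numerator i j d′) (N n k d′)
    Bfun≡frac i j i≢j d′ = cong (inv (toℚ (d i)) *_) (begin
      sumℚ (map (λ K → P n k (K ∪ (⁅ i ⁆ ∪ ⁅ j ⁆)) d′) (avoiding (k ∸ 2))) + sumℚ (map (λ K → Y n k i K j d′) (avoiding (k ∸ 1)))
        ≡⟨ cong (λ ys → sumℚ (map (λ K → P n k (K ∪ (⁅ i ⁆ ∪ ⁅ j ⁆)) d′) (avoiding (k ∸ 2))) + sumℚ ys)
                (LP.map-cong (λ K → Y≡frac n k i K j d′ i≢j) (avoiding (k ∸ 1))) ⟩
      sumℚ (map (λ K → frac (NL n k (K ∪ (⁅ i ⁆ ∪ ⁅ j ⁆)) d′) (N n k d′)) (avoiding (k ∸ 2)))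
        + sumℚ (map (λ K → frac (NJL n k (K ∪ ⁅ i ⁆) (K ∪ ⁅ j ⁆) d′) (N n k d′)) (avoiding (k ∸ 1)))
        ≡⟨ cong₂ _+_ (sumℚ-frac _ (N n k d′) (avoiding (k ∸ 2))) (sumℚ-frac _ (N n k d′) (avoiding (k ∸ 1))) ⟩
      frac (∑ (λ K → NL n k (K ∪ (⁅ i ⁆ ∪ ⁅ j ⁆)) d′) (avoiding (k ∸ 2))) (N n k d′)
        + frac (∑ (λ K → NJL n k (K ∪ ⁅ i ⁆) (K ∪ ⁅ j ⁆) d′) (avoiding (k ∸ 1))) (N n k d′)
        ≡⟨ frac-+ _ _ (N n k d′) ⟩
      frac (B-numerator i j d′) (N n k d′) ∎)
      where open ≡-Reasoning

    degree-split : ∀ i j → i ≢ j → (∀ K → avoids-ab K ≡ (not (memᵇ i K) ∧ not (memᵇ j K))) →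
      (d′ : DegSeq n) (m : ℕ) → d′ i ≡ ℤ.+ m → m ℕ.* N n k d′ ≡ B-numerator i j d′ ℕ.+ B-slack i j d′
    degree-split i j i≢j avoids≡ d′ m d′i≡m = begin
      m ℕ.* N n k d′
        ≡⟨ sym (∑-NL-through-pair k i j i≢j avoids-ab avoids≡ d′ m d′i≡m) ⟩
      ∑ (λ K → NL n k (K ∪ (⁅ i ⁆ ∪ ⁅ j ⁆)) d′) (avoiding (k ∸ 2)) ℕ.+ ∑ (λ K → NL n k (K ∪ ⁅ i ⁆) d′) (avoiding (k ∸ 1))
        ≡⟨ cong (∑ (λ K → NL n k (K ∪ (⁅ i ⁆ ∪ ⁅ j ⁆)) d′) (avoiding (k ∸ 2)) ℕ.+_)
                (trans (∑-cong (avoiding (k ∸ 1)) with-or-without-j) (∑-+ _ _ (avoiding (k ∸ 1)))) ⟩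
      ∑ (λ K → NL n k (K ∪ (⁅ i ⁆ ∪ ⁅ j ⁆)) d′) (avoiding (k ∸ 2))
        ℕ.+ (∑ (λ K → NJL n k (K ∪ ⁅ i ⁆) (K ∪ ⁅ j ⁆) d′) (avoiding (k ∸ 1)) ℕ.+ B-slack i j d′)
        ≡⟨ sym (ℕP.+-assoc (∑ (λ K → NL n k (K ∪ (⁅ i ⁆ ∪ ⁅ j ⁆)) d′) (avoiding (k ∸ 2)))
                           (∑ (λ K → NJL n k (K ∪ ⁅ i ⁆) (K ∪ ⁅ j ⁆) d′) (avoiding (k ∸ 1))) (B-slack i j d′)) ⟩
      B-numerator i j d′ ℕ.+ B-slack i j d′ ∎
      where
      open ≡-Reasoning
      with-or-without-j : ∀ K →
        NL n k (K ∪ ⁅ i ⁆) d′ ≡ NJL n k (K ∪ ⁅ i ⁆) (K ∪ ⁅ j ⁆) d′ ℕ.+ NL-without d′ (K ∪ ⁅ i ⁆) (K ∪ ⁅ j ⁆)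
      with-or-without-j K = trans (count-split (λ G → hasDegSeq d′ G ∧ hasEdge (K ∪ ⁅ i ⁆) G) (hasEdge (K ∪ ⁅ j ⁆)) (kGraphs n k))
        (cong (ℕ._+ NL-without d′ (K ∪ ⁅ i ⁆) (K ∪ ⁅ j ⁆))
              (count-cong (kGraphs n k) (λ G → BP.∧-assoc (hasDegSeq d′ G) (hasEdge (K ∪ ⁅ i ⁆) G) (hasEdge (K ∪ ⁅ j ⁆) G))))

    ∧-swap-right : ∀ x y z → ((x ∧ y) ∧ z) ≡ ((x ∧ z) ∧ y)
    ∧-swap-right x y z rewrite BP.∧-assoc x y z | BP.∧-assoc x z y | BP.∧-comm y z = refl

    -- Deleting K ∪ {a} from the left-hand graphs, resp. K ∪ {b} from the right-hand ones, gives in both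
    -- cases the graphs with degrees d − e_a − e_b − e_K containing neither edge.
    NL-without-swap : ∀ K → ∣ K ∣ ≡ k ∸ 1 → a ∉ K → b ∉ K →
      NL-without (d −e ⁅ b ⁆) (K ∪ ⁅ a ⁆) (K ∪ ⁅ b ⁆) ≡ NL-without (d −e ⁅ a ⁆) (K ∪ ⁅ b ⁆) (K ∪ ⁅ a ⁆)
    NL-without-swap K ∣K∣≡k-1 a∉K b∉K = begin
      NL-without (d −e ⁅ b ⁆) Ka Kb
        ≡⟨ count-cong (kGraphs n k) (λ G → ∧-swap-right (hasDegSeq (d −e ⁅ b ⁆) G) (hasEdge Ka G) (not (hasEdge Kb G))) ⟩
      count (λ G → (hasDegSeq (d −e ⁅ b ⁆) G ∧ not (hasEdge Kb G)) ∧ hasEdge Ka G) (kGraphs n k)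
        ≡⟨ edge-removal n k Ka ∣Ka∣≡k (d −e ⁅ b ⁆) (λ G → not (hasEdge Kb G))
             (λ ys H → cong not (hasEdge-insert Kb ys Ka H (∪⁅⁆-distinct K a b a∉K a≢b))) ⟩
      count (λ G → (hasDegSeq ((d −e ⁅ b ⁆) −e Ka) G ∧ not (hasEdge Kb G)) ∧ not (hasEdge Ka G)) (kGraphs n k)
        ≡⟨ count-cong (kGraphs n k) (λ G → trans
             (cong (λ u → (u ∧ not (hasEdge Kb G)) ∧ not (hasEdge Ka G)) (hasDegSeq-cong both-removed G))
             (∧-swap-right (hasDegSeq ((d −e ⁅ a ⁆) −e Kb) G) (not (hasEdge Kb G)) (not (hasEdge Ka G)))) ⟩
      count (λ G → (hasDegSeq ((d −e ⁅ a ⁆) −e Kb) G ∧ not (hasEdge Ka G)) ∧ not (hasEdge Kb G)) (kGraphs n k)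
        ≡⟨ sym (edge-removal n k Kb ∣Kb∣≡k (d −e ⁅ a ⁆) (λ G → not (hasEdge Ka G))
             (λ ys H → cong not (hasEdge-insert Ka ys Kb H (∪⁅⁆-distinct K b a b∉K (a≢b ∘ sym))))) ⟩
      count (λ G → (hasDegSeq (d −e ⁅ a ⁆) G ∧ not (hasEdge Ka G)) ∧ hasEdge Kb G) (kGraphs n k)
        ≡⟨ count-cong (kGraphs n k) (λ G → ∧-swap-right (hasDegSeq (d −e ⁅ a ⁆) G) (not (hasEdge Ka G)) (hasEdge Kb G)) ⟩
      NL-without (d −e ⁅ a ⁆) Kb Ka ∎
      where
      open ≡-Reasoning
      Ka Kb : Subset n
      Ka = K ∪ ⁅ a ⁆
      Kb = K ∪ ⁅ b ⁆
      ∣Ka∣≡k : ∣ Ka ∣ ≡ k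
      ∣Ka∣≡k = ∣∪⁅⁆∣≡k k K a k≥1 ∣K∣≡k-1 a∉K
      ∣Kb∣≡k : ∣ Kb ∣ ≡ k
      ∣Kb∣≡k = ∣∪⁅⁆∣≡k k K b k≥1 ∣K∣≡k-1 b∉K
      b∉Ka : b ∉ Ka
      b∉Ka = memᵇ≡false⇒∉ (trans (mem-∪⁅⁆ a b K) (cong₂ _∨_ (∉⇒memᵇ≡false b∉K) (dec-false (a FP.≟ b) a≢b)))
      a∉Kb : a ∉ Kb
      a∉Kb = memᵇ≡false⇒∉ (trans (mem-∪⁅⁆ b a K) (cong₂ _∨_ (∉⇒memᵇ≡false a∉K) (dec-false (b FP.≟ a) (a≢b ∘ sym))))
      Ka∪b≡Kb∪a : Ka ∪ ⁅ b ⁆ ≡ Kb ∪ ⁅ a ⁆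
      Ka∪b≡Kb∪a = trans (SubsetP.∪-assoc K ⁅ a ⁆ ⁅ b ⁆)
                   (trans (cong (K ∪_) (SubsetP.∪-comm ⁅ a ⁆ ⁅ b ⁆)) (sym (SubsetP.∪-assoc K ⁅ b ⁆ ⁅ a ⁆)))
      both-removed : ∀ x → ((d −e ⁅ b ⁆) −e Ka) x ≡ ((d −e ⁅ a ⁆) −e Kb) x
      both-removed x = trans (−e⁅⁆-−e d b Ka b∉Ka x)
                       (trans (cong (λ S → (d −e S) x) Ka∪b≡Kb∪a) (sym (−e⁅⁆-−e d a Kb a∉Kb x)))

    B-slack-swap : B-slack a b (d −e ⁅ b ⁆) ≡ B-slack b a (d −e ⁅ a ⁆)
    B-slack-swap = ∑-congᴬ (avoiding (k ∸ 1)) (All.map (λ {K} (∣K∣≡k-1 , avoids-K) → swap-K {K} ∣K∣≡k-1 (∧≡true⇒ avoids-K))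
      (All.zip (AllP.filter⁺ _ (kSubsets-card n (k ∸ 1)) , all-filterᵇ avoids-ab (kSubsets n (k ∸ 1)))))
      where
      swap-K : ∀ {K} → ∣ K ∣ ≡ k ∸ 1 → not (memᵇ a K) ≡ true × not (memᵇ b K) ≡ true →
        NL-without (d −e ⁅ b ⁆) (K ∪ ⁅ a ⁆) (K ∪ ⁅ b ⁆) ≡ NL-without (d −e ⁅ a ⁆) (K ∪ ⁅ b ⁆) (K ∪ ⁅ a ⁆)
      swap-K {K} ∣K∣≡k-1 (a∉K , b∉K) =
        NL-without-swap K ∣K∣≡k-1 (memᵇ≡false⇒∉ (not≡true⇒ a∉K)) (memᵇ≡false⇒∉ (not≡true⇒ b∉K))

    −e⁅⁆-other : ∀ (x y : Fin n) → y ≢ x → (d −e ⁅ y ⁆) x ≡ d x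
    −e⁅⁆-other x y y≢x rewrite mem-⁅⁆-other y x y≢x = ℤP.+-identityʳ (d x)

  R-via-B : 0 ℕ.< N n k (d −e ⁅ a ⁆) → 0 ℕ.< N n k (d −e ⁅ b ⁆) → Bfun n k d a b b a (d −e ⁅ a ⁆) < 1ℚ →
    R n k a b d ≡
      (toℚ (d a) * inv (toℚ (d b)))
      * ((1ℚ - Bfun n k d a b a b (d −e ⁅ b ⁆)) * inv (1ℚ - Bfun n k d a b b a (d −e ⁅ a ⁆)))
  R-via-B Na>0 Nb>0 Bba<1
    with graphical-−e⁅⁆⇒degree-positive n k d a Na>0 | graphical-−e⁅⁆⇒degree-positive n k d b Nb>0
  ... | ta , da≡ | tb , db≡ = begin
    frac Na Nb
      ≡⟨ ratio-from-double-counting (suc ta) (suc tb) Na Nb Xa Xb (B-slack a b (d −e ⁅ b ⁆))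
           (λ ()) (λ ()) (ℕP.>⇒≢ Na>0) (ℕP.>⇒≢ Nb>0) maNb≡Xb+S mbNa≡Xa+S (subst (_< 1ℚ) Bba≡ Bba<1) ⟩
    (fromℕ (suc ta) * inv (fromℕ (suc tb)))
      * ((1ℚ - inv (fromℕ (suc ta)) * frac Xb Nb) * inv (1ℚ - inv (fromℕ (suc tb)) * frac Xa Na))
      ≡⟨ cong₂ (λ x y → (x * inv y) * ((1ℚ - inv x * frac Xb Nb) * inv (1ℚ - inv y * frac Xa Na)))
               (cong toℚ (sym da≡)) (cong toℚ (sym db≡)) ⟩
    (toℚ (d a) * inv (toℚ (d b)))
      * ((1ℚ - inv (toℚ (d a)) * frac Xb Nb) * inv (1ℚ - inv (toℚ (d b)) * frac Xa Na))
      ≡⟨ cong₂ (λ x y → (toℚ (d a) * inv (toℚ (d b))) * ((1ℚ - x) * inv (1ℚ - y)))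
               (sym (Bfun≡frac a b a≢b (d −e ⁅ b ⁆))) (sym (Bfun≡frac b a (a≢b ∘ sym) (d −e ⁅ a ⁆))) ⟩
    (toℚ (d a) * inv (toℚ (d b)))
      * ((1ℚ - Bfun n k d a b a b (d −e ⁅ b ⁆)) * inv (1ℚ - Bfun n k d a b b a (d −e ⁅ a ⁆))) ∎
    where
    open ≡-Reasoning
    Na Nb Xa Xb : ℕ
    Na = N n k (d −e ⁅ a ⁆)
    Nb = N n k (d −e ⁅ b ⁆)
    Xa = B-numerator b a (d −e ⁅ a ⁆)
    Xb = B-numerator a b (d −e ⁅ b ⁆)
    maNb≡Xb+S : suc ta ℕ.* Nb ≡ Xb ℕ.+ B-slack a b (d −e ⁅ b ⁆)
    maNb≡Xb+S = degree-split a b a≢b (λ _ → refl) (d −e ⁅ b ⁆) (suc ta) (trans (−e⁅⁆-other a b (a≢b ∘ sym)) da≡)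
    mbNa≡Xa+S : suc tb ℕ.* Na ≡ Xa ℕ.+ B-slack a b (d −e ⁅ b ⁆)
    mbNa≡Xa+S = trans (degree-split b a (a≢b ∘ sym) (λ K → BP.∧-comm (not (memᵇ a K)) (not (memᵇ b K))) (d −e ⁅ a ⁆) (suc tb)
                        (trans (−e⁅⁆-other b a a≢b) db≡))
                      (cong (Xa ℕ.+_) (sym B-slack-swap))
    Bba≡ : Bfun n k d a b b a (d −e ⁅ a ⁆) ≡ inv (fromℕ (suc tb)) * frac Xa Na
    Bba≡ = trans (Bfun≡frac b a (a≢b ∘ sym) (d −e ⁅ a ⁆)) (cong (λ x → inv (toℚ x) * frac Xa Na) db≡)

lemma3p2 : (n k : ℕ) → 2 ≤ k → k ≤ n → (d : DegSeq n) →
    -- (a)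
    ((a b : Fin n) → a ≢ b →
      0 ℕ.< N n k (d −e ⁅ a ⁆) → 0 ℕ.< N n k (d −e ⁅ b ⁆) →
      Bfun n k d a b b a (d −e ⁅ a ⁆) < 1ℚ →
      R n k a b d ≡
        (toℚ (d a) * inv (toℚ (d b)))
        * ((1ℚ - Bfun n k d a b a b (d −e ⁅ b ⁆))
           * inv (1ℚ - Bfun n k d a b b a (d −e ⁅ a ⁆))))
  × -- (b)
    ((A : Subset n) → ∣ A ∣ ≡ k ℕ.∸ 1 → (v : Fin n) → v ∉ A →
      0ℚ < P n k (A ∪ ⁅ v ⁆) d →
      ((B : Subset n) → ∣ B ∣ ≡ k ℕ.∸ 1 → v ∉ B → (j : ℕ) → j ≤ k ℕ.∸ 1 →
        0 ℕ.< N n k ((d −e ⁅ v ⁆) −e mixSet A B j)) →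
      P n k (A ∪ ⁅ v ⁆) d ≡
        toℚ (d v) * inv (sumℚ (map (λ B →
            RBA n k B A (d −e ⁅ v ⁆)
            * ((1ℚ - P n k (B ∪ ⁅ v ⁆) (d −e (B ∪ ⁅ v ⁆)))
               * inv (1ℚ - P n k (A ∪ ⁅ v ⁆) (d −e (A ∪ ⁅ v ⁆)))))
          (kSubsetsAvoiding n (k ℕ.∸ 1) v))))
  × -- (c)
    ((K : Subset n) → ∣ K ∣ ≡ k ℕ.∸ 1 → (a b : Fin n) → a ∉ K → b ∉ K → a ≢ b →
      0 ℕ.< N n k d → 0 ℕ.< N n k (d −e (K ∪ ⁅ a ⁆)) →
      P n k (K ∪ ⁅ a ⁆) (d −e (K ∪ ⁅ a ⁆)) < 1ℚ →
      Y n k a K b d ≡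
        (P n k (K ∪ ⁅ a ⁆) d * inv (1ℚ - P n k (K ∪ ⁅ a ⁆) (d −e (K ∪ ⁅ a ⁆))))
        * (P n k (K ∪ ⁅ b ⁆) (d −e (K ∪ ⁅ a ⁆)) - Y n k a K b (d −e (K ∪ ⁅ a ⁆))))
lemma3p2 n k 2≤k _ d =
    (λ a b a≢b → R-via-B n k k≥1 d a b a≢b)
  , (λ A ∣A∣≡k-1 v v∉A → P-via-RBA n k k≥1 d A ∣A∣≡k-1 v v∉A)
  , (λ K ∣K∣≡k-1 a b a∉K _ a≢b _ → Y-recurrence n k d K k≥1 ∣K∣≡k-1 a b a∉K a≢b)
  where
  k≥1 : 1 ≤ k
  k≥1 = ℕP.≤-trans (s≤s z≤n) 2≤k
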